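{- Let $k\ge2$, let $p_1,\dots,p_k$ be distinct primes and $n=p_1\cdots p_k$. Let $$f(x)=(1-x^{n})\cdot\frac{\prod_{i=2}^k\bigl(1-x^{p_2\cdots p_k/p_i}\bigr)}{\prod_{i=1}^k\bigl(1-x^{n/p_i}\bigr)},$$ regarded as a formal power series in $\mathbb{Z}[[x]]$, and let $f^*$ be the unique polynomial of degree less than $n$ with $f^*\equiv f\pmod{x^{n}}$. Then $$H(f^*)\le b_{k-2}:=\binom{k-2}{\lfloor (k-2)/2\rfloor}.$$
   Context: For a formal power series $g(x)=\sum_{m\ge0}a_mx^m\in\mathbb{Z}[[x]]$, its height is $H(g)=\max_{m\ge0}|a_m|$. -}

module Defs where

open import Data.Nat as ℕ using (ℕ; zero; suc; _∸_; _<?_)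
open import Data.Integer as ℤ using (ℤ; 0ℤ; 1ℤ)
open import Data.Fin using (Fin)
open import Function using (_∘_)
open import Relation.Nullary using (yes; no)

PowerSeries : Set
PowerSeries = ℕ → ℤ

X^ : ℕ → PowerSeries
X^ a m with a ℕ.≟ m
... | yes _ = 1ℤ
... | no  _ = 0ℤ

oneₛ : PowerSeries
oneₛ = X^ 0

_-ₛ_ : PowerSeries → PowerSeries → PowerSeries
(f -ₛ g) m = f m ℤ.- g m

sumTo : ℕ → (ℕ → ℤ) → ℤ
sumTo zero    h = h 0
sumTo (suc m) h = sumTo m h ℤ.+ h (suc m)

_*ₛ_ : PowerSeries → PowerSeries → PowerSeries
(f *ₛ g) m = sumTo m (λ i → f i ℤ.* g (m ∸ i))

oneMinusX^ : ℕ → PowerSeries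
oneMinusX^ a = oneₛ -ₛ X^ a

∏ₛ : ∀ {k} → (Fin k → PowerSeries) → PowerSeries
∏ₛ {zero}  F = oneₛ
∏ₛ {suc k} F = F Fin.zero *ₛ ∏ₛ (F ∘ Fin.suc)

∏ℕ : ∀ {k} → (Fin k → ℕ) → ℕ
∏ℕ {zero}  p = 1
∏ℕ {suc k} p = p Fin.zero ℕ.* ∏ℕ (p ∘ Fin.suc)

-- products over the indices 2..k (i.e. omitting the first index)
∏ℕ⁺ : ∀ {k} → (Fin k → ℕ) → ℕ
∏ℕ⁺ {zero}  p = 1
∏ℕ⁺ {suc k} p = ∏ℕ (p ∘ Fin.suc)

∏ₛ⁺ : ∀ {k} → (Fin k → PowerSeries) → PowerSeries
∏ₛ⁺ {zero}  F = oneₛ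
∏ₛ⁺ {suc k} F = ∏ₛ (F ∘ Fin.suc)

-- natural-number division (floor); only applied to nonzero divisors (primes)
_÷_ : ℕ → ℕ → ℕ
a ÷ zero  = 0
a ÷ suc b = a ℕ./ suc b

truncate : ℕ → PowerSeries → PowerSeries
truncate n f m with m <? n
... | yes _ = f m
... | no  _ = 0ℤ

numerator : ∀ {k} → (Fin k → ℕ) → PowerSeries
numerator p = oneMinusX^ (∏ℕ p) *ₛ ∏ₛ⁺ (λ i → oneMinusX^ (∏ℕ⁺ p ÷ p i))

denominator : ∀ {k} → (Fin k → ℕ) → PowerSeries
denominator p = ∏ₛ (λ i → oneMinusX^ (∏ℕ p ÷ p i))

module Submission where

-- Write q = p₁, P = (p₂, …, p_k), m = n / q and aₗ = m / Pₗ. Then f is (1 - xⁿ) ∏ₗ (1 - x^aₗ) divided by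
-- (1 - x^m) ∏ₗ (1 - x^{q aₗ}), so modulo xⁿ it agrees with E = ∏ₗ (1 - x^aₗ)/(1 - x^{q aₗ}) · 1/(1 - x^m).
-- The coefficient of x^t in E is a signed count of the ways of writing t = Σₗ (jₗ q + εₗ) aₗ + j m with εₗ ∈ {0, 1}.
-- For t < n, reducing modulo Pₗ determines jₗ from εₗ, after which j is determined as well (Chinese remainder
-- theorem); hence the coefficient is Σ_{S ⊆ L} (-1)^|S| [Σ_{l ∈ S} wₗ ≤ c] for some integers c and wₗ, |L| = k - 1.
-- Making the weights nonnegative and putting the smallest one, y, first turns this into a signed sum over the subsets S
-- of the remaining k - 2 weights of the indicator of c - y < Σ S ≤ c. Consecutive sums along a chain of subsets differ
-- by at least y, so each chain of a symmetric chain decomposition contributes at most ±1, and there are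
-- C(k - 2, ⌊(k - 2)/2⌋) such chains.

module SignedSubsetCounts where

  open import Data.Nat as ℕ using (ℕ; zero; suc; _∸_; z≤n)
  import Data.Nat.Properties as ℕP
  open import Data.Nat.Combinatorics using (_C_; nCk+nC[k+1]≡[n+1]C[k+1])
  open import Data.Nat.DivMod using (_/_; m*n/n≡m; /-monoˡ-≤; m<n*o⇒m/o<n)
  open import Data.Integer as ℤ using (ℤ; +_; 0ℤ; 1ℤ; -1ℤ; _+_; _-_; -_; _*_; _^_; _≤_; ∣_∣)
  import Data.Integer.Properties as ℤP
  open import Data.Integer.Tactic.RingSolver using (solve-∀)
  import Data.Nat.Tactic.RingSolver as ℕ-Solver
  open import Data.List using (List; []; _∷_; length; map; _++_; concatMap)
  open import Data.List.Properties using (length-map)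
  open import Data.List.Relation.Unary.All as All using (All; []; _∷_)
  import Data.List.Relation.Unary.All.Properties as AllP
  open import Data.List.Relation.Unary.Linked as Linked using (Linked; []; [-]; _∷_)
  open import Data.List.Relation.Unary.Linked.Properties using (Linked⇒All; map⁺)
  open import Data.List.Relation.Binary.Permutation.Propositional as ↭ using (_↭_; ↭-sym)
  open import Data.List.Relation.Binary.Permutation.Propositional.Properties using (All-resp-↭; ↭-length)
  open import Data.List.Sort ℤP.≤-decTotalOrder using (sort; sort-↭; sort-↗)
  open import Data.Product using (Σ-syntax; _×_; _,_; proj₁; proj₂)
  open import Data.Sum using (inj₁; inj₂)
  open import Data.Empty using (⊥)
  open import Function using (_∘_)
  open import Relation.Nullary using (Dec; yes; no; ¬_; contradiction)
  open import Relation.Binary.PropositionalEquality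
  open import Relation.Binary.Definitions using (Transitive)

  ⟦_≤_⟧ : ℤ → ℤ → ℤ
  ⟦ x ≤ y ⟧ with x ℤP.≤? y
  ... | yes _ = 1ℤ
  ... | no  _ = 0ℤ

  ⟦≤⟧-true : ∀ {x y} → x ≤ y → ⟦ x ≤ y ⟧ ≡ 1ℤ
  ⟦≤⟧-true {x} {y} x≤y with x ℤP.≤? y
  ... | yes _   = refl
  ... | no  x≰y = contradiction x≤y x≰y

  ⟦≤⟧-false : ∀ {x y} → ¬ x ≤ y → ⟦ x ≤ y ⟧ ≡ 0ℤ
  ⟦≤⟧-false {x} {y} x≰y with x ℤP.≤? y
  ... | yes x≤y = contradiction x≤y x≰y
  ... | no  _   = refl

  ⟦≤⟧-cong : ∀ {x y u v} → x - y ≡ u - v → ⟦ x ≤ y ⟧ ≡ ⟦ u ≤ v ⟧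
  ⟦≤⟧-cong {x} {y} {u} {v} eq with u ℤP.≤? v
  ... | yes u≤v = ⟦≤⟧-true (ℤP.i-j≤0⇒i≤j (subst (_≤ 0ℤ) (sym eq) (ℤP.i≤j⇒i-j≤0 u≤v)))
  ... | no  u≰v = ⟦≤⟧-false (λ x≤y → u≰v (ℤP.i-j≤0⇒i≤j (subst (_≤ 0ℤ) eq (ℤP.i≤j⇒i-j≤0 x≤y))))

  -- signedCount ws c = Σ_{S ⊆ ws} (-1)^|S| ⟦ Σ S ≤ c ⟧, the coefficient of x^c in ∏_{w ∈ ws} (1 - x^w) / (1 - x).
  signedCount : List ℤ → ℤ → ℤ
  signedCount []       c = ⟦ 0ℤ ≤ c ⟧
  signedCount (w ∷ ws) c = signedCount ws c - signedCount ws (c - w)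

  signedCount-swap : ∀ x y ws c → signedCount (x ∷ y ∷ ws) c ≡ signedCount (y ∷ x ∷ ws) c
  signedCount-swap x y ws c =
    trans (cong (λ z → S c - S (c - y) - (S (c - x) - S z)) (swap c x y))
          (regroup (S c) (S (c - y)) (S (c - x)) (S (c - y - x)))
    where
    S = signedCount ws
    swap : ∀ c x y → c - x - y ≡ c - y - x
    swap = solve-∀
    regroup : ∀ a b e d → a - b - (e - d) ≡ a - e - (b - d)
    regroup = solve-∀

  signedCount-cong : ∀ w xs ys → (∀ c → signedCount xs c ≡ signedCount ys c) →
                     ∀ c → signedCount (w ∷ xs) c ≡ signedCount (w ∷ ys) c
  signedCount-cong w xs ys eq c = cong₂ _-_ (eq c) (eq (c - w))

  signedCount-↭ : ∀ {xs ys} → xs ↭ ys → ∀ c → signedCount xs c ≡ signedCount ys c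
  signedCount-↭ ↭.refl                  c = refl
  signedCount-↭ (↭.prep {xs} {ys} w p)   c = signedCount-cong w xs ys (signedCount-↭ p) c
  signedCount-↭ (↭.swap {xs} {ys} x y p) c = trans (signedCount-swap x y xs c)
    (signedCount-cong y (x ∷ xs) (x ∷ ys) (signedCount-cong x xs ys (signedCount-↭ p)) c)
  signedCount-↭ (↭.trans p q)            c = trans (signedCount-↭ p c) (signedCount-↭ q c)

  record _≈_ (ws vs : List ℤ) : Set where
    constructor ≈⟨_,_,_,_⟩
    field
      σ       : ℤ
      d       : ℤ
      ∣σ∣≡1   : ∣ σ ∣ ≡ 1
      related : ∀ c → signedCount ws c ≡ σ * signedCount vs (c + d)

  ≈-∣signedCount∣ : ∀ {ws vs} → ws ≈ vs → Σ[ d ∈ ℤ ] (∀ c → ∣ signedCount ws c ∣ ≡ ∣ signedCount vs (c + d) ∣)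
  ≈-∣signedCount∣ {ws} {vs} ≈⟨ σ , d , ∣σ∣≡1 , eq ⟩ = d , λ c → begin
    ∣ signedCount ws c ∣                   ≡⟨ cong ∣_∣ (eq c) ⟩
    ∣ σ * signedCount vs (c + d) ∣         ≡⟨ ℤP.abs-* σ _ ⟩
    ∣ σ ∣ ℕ.* ∣ signedCount vs (c + d) ∣   ≡⟨ cong (ℕ._* _) ∣σ∣≡1 ⟩
    1 ℕ.* ∣ signedCount vs (c + d) ∣       ≡⟨ ℕP.*-identityˡ _ ⟩
    ∣ signedCount vs (c + d) ∣             ∎
    where open ≡-Reasoning

  ≈-trans : ∀ {us vs ws} → us ≈ vs → vs ≈ ws → us ≈ ws
  ≈-trans {ws = ws} ≈⟨ σ , d , ∣σ∣≡1 , eq ⟩ ≈⟨ τ , e , ∣τ∣≡1 , eq′ ⟩ =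
    ≈⟨ σ * τ , d + e , trans (ℤP.abs-* σ τ) (cong₂ ℕ._*_ ∣σ∣≡1 ∣τ∣≡1) , (λ c →
      trans (eq c) (trans (cong (σ *_) (eq′ (c + d)))
        (trans (sym (ℤP.*-assoc σ τ _)) (cong (λ z → σ * τ * signedCount ws z) (ℤP.+-assoc c d e))))) ⟩

  ≈-cons : ∀ w {ws vs} → ws ≈ vs → (w ∷ ws) ≈ (w ∷ vs)
  ≈-cons w {ws} {vs} ≈⟨ σ , d , ∣σ∣≡1 , eq ⟩ = ≈⟨ σ , d , ∣σ∣≡1 , (λ c → begin
    signedCount ws c - signedCount ws (c - w)  ≡⟨ cong₂ _-_ (eq c) (eq (c - w)) ⟩
    σ * S (c + d) - σ * S (c - w + d)          ≡⟨ cong (λ z → σ * S (c + d) - σ * S z) (swap-+ c w d) ⟩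
    σ * S (c + d) - σ * S (c + d - w)          ≡⟨ factor σ _ _ ⟩
    σ * (S (c + d) - S (c + d - w))            ∎) ⟩
    where
    open ≡-Reasoning
    S = signedCount vs
    swap-+ : ∀ c w d → c - w + d ≡ c + d - w
    swap-+ = solve-∀
    factor : ∀ σ x y → σ * x - σ * y ≡ σ * (x - y)
    factor = solve-∀

  ≈-negateHead : ∀ w ws → (w ∷ ws) ≈ (- w ∷ ws)
  ≈-negateHead w ws = ≈⟨ -1ℤ , - w , refl , (λ c → begin
    S c - S (c - w)                        ≡⟨ cong (λ z → S z - S (c - w)) (cancel c w) ⟩
    S (c - w - - w) - S (c - w)            ≡⟨ flip (S (c - w - - w)) (S (c - w)) ⟩
    -1ℤ * (S (c - w) - S (c - w - - w))    ∎) ⟩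
    where
    open ≡-Reasoning
    S = signedCount ws
    cancel : ∀ c w → c ≡ c - w - - w
    cancel = solve-∀
    flip : ∀ x y → x - y ≡ -1ℤ * (y - x)
    flip = solve-∀

  ≈-↭ : ∀ {ws vs} → ws ↭ vs → ws ≈ vs
  ≈-↭ {vs = vs} p = ≈⟨ 1ℤ , 0ℤ , refl , (λ c →
    trans (signedCount-↭ p c) (sym (trans (ℤP.*-identityˡ _) (cong (signedCount vs) (ℤP.+-identityʳ c))))) ⟩

  ≈-absWeights : ∀ ws → ws ≈ map (+_ ∘ ∣_∣) ws
  ≈-absWeights []       = ≈-↭ ↭.refl
  ≈-absWeights (w ∷ ws) with ℤP.+∣i∣≡i⊎+∣i∣≡-i w
  ... | inj₁ ∣w∣≡w  = subst (λ v → (w ∷ ws) ≈ (v ∷ map (+_ ∘ ∣_∣) ws)) (sym ∣w∣≡w)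
                        (≈-cons w (≈-absWeights ws))
  ... | inj₂ ∣w∣≡-w = subst (λ v → (w ∷ ws) ≈ (v ∷ map (+_ ∘ ∣_∣) ws)) (sym ∣w∣≡-w)
                        (≈-trans (≈-cons w (≈-absWeights ws)) (≈-negateHead w _))

  sumOverSubsets : List ℤ → (ℕ → ℤ → ℤ) → ℤ
  sumOverSubsets []       g = g 0 0ℤ
  sumOverSubsets (w ∷ ws) g = sumOverSubsets ws g + sumOverSubsets ws (λ s v → g (suc s) (v + w))

  sumOverSubsets-cong : ∀ ws {g h} → (∀ s v → g s v ≡ h s v) → sumOverSubsets ws g ≡ sumOverSubsets ws h
  sumOverSubsets-cong []       eq = eq 0 0ℤ
  sumOverSubsets-cong (w ∷ ws) eq =
    cong₂ _+_ (sumOverSubsets-cong ws eq) (sumOverSubsets-cong ws (λ s v → eq (suc s) (v + w)))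

  sumOverSubsets-neg : ∀ ws g → sumOverSubsets ws (λ s v → - g s v) ≡ - sumOverSubsets ws g
  sumOverSubsets-neg []       g = refl
  sumOverSubsets-neg (w ∷ ws) g =
    trans (cong₂ _+_ (sumOverSubsets-neg ws g) (sumOverSubsets-neg ws (λ s v → g (suc s) (v + w))))
          (sym (ℤP.neg-distrib-+ (sumOverSubsets ws g) (sumOverSubsets ws (λ s v → g (suc s) (v + w)))))

  sumOverSubsets-+ : ∀ ws g h → sumOverSubsets ws (λ s v → g s v + h s v) ≡ sumOverSubsets ws g + sumOverSubsets ws h
  sumOverSubsets-+ []       g h = refl
  sumOverSubsets-+ (w ∷ ws) g h =
    trans (cong₂ _+_ (sumOverSubsets-+ ws g h) (sumOverSubsets-+ ws _ _))
          (interchange (sumOverSubsets ws g) (sumOverSubsets ws h) _ _)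
    where
    interchange : ∀ a b e d → a + b + (e + d) ≡ a + e + (b + d)
    interchange = solve-∀

  sumOverSubsets-- : ∀ ws g h → sumOverSubsets ws (λ s v → g s v - h s v) ≡ sumOverSubsets ws g - sumOverSubsets ws h
  sumOverSubsets-- ws g h =
    trans (sumOverSubsets-+ ws g (λ s v → - h s v)) (cong (λ z → sumOverSubsets ws g + z) (sumOverSubsets-neg ws h))

  signedCount-sumOverSubsets : ∀ ws c → signedCount ws c ≡ sumOverSubsets ws (λ s v → -1ℤ ^ s * ⟦ v ≤ c ⟧)
  signedCount-sumOverSubsets []       c = sym (ℤP.*-identityˡ _)
  signedCount-sumOverSubsets (w ∷ ws) c = begin
    signedCount ws c - signedCount ws (c - w)
      ≡⟨ cong₂ _-_ (signedCount-sumOverSubsets ws c) (signedCount-sumOverSubsets ws (c - w)) ⟩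
    sumOverSubsets ws (λ s v → -1ℤ ^ s * ⟦ v ≤ c ⟧) - sumOverSubsets ws (λ s v → -1ℤ ^ s * ⟦ v ≤ c - w ⟧)
      ≡⟨ sym (cong (λ z → A + z) (sumOverSubsets-neg ws _)) ⟩
    sumOverSubsets ws (λ s v → -1ℤ ^ s * ⟦ v ≤ c ⟧) + sumOverSubsets ws (λ s v → - (-1ℤ ^ s * ⟦ v ≤ c - w ⟧))
      ≡⟨ cong (λ z → A + z) (sumOverSubsets-cong ws (λ s v →
           trans (negate (-1ℤ ^ s) _) (cong (-1ℤ ^ suc s *_) (⟦≤⟧-cong (shift v c w))))) ⟩
    sumOverSubsets ws (λ s v → -1ℤ ^ s * ⟦ v ≤ c ⟧) + sumOverSubsets ws (λ s v → -1ℤ ^ suc s * ⟦ v + w ≤ c ⟧)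
      ∎
    where
    open ≡-Reasoning
    A = sumOverSubsets ws (λ s v → -1ℤ ^ s * ⟦ v ≤ c ⟧)
    negate : ∀ a b → - (a * b) ≡ -1ℤ * a * b
    negate = solve-∀
    shift : ∀ v c w → v - (c - w) ≡ v + w - c
    shift = solve-∀

  window : ℤ → ℤ → ℕ → ℤ → ℤ
  window c y s v = -1ℤ ^ s * (⟦ v ≤ c ⟧ - ⟦ v ≤ c - y ⟧)

  signedCount-window : ∀ y ys c → signedCount (y ∷ ys) c ≡ sumOverSubsets ys (window c y)
  signedCount-window y ys c = begin
    signedCount ys c - signedCount ys (c - y)
      ≡⟨ cong₂ _-_ (signedCount-sumOverSubsets ys c) (signedCount-sumOverSubsets ys (c - y)) ⟩
    sumOverSubsets ys (λ s v → -1ℤ ^ s * ⟦ v ≤ c ⟧) - sumOverSubsets ys (λ s v → -1ℤ ^ s * ⟦ v ≤ c - y ⟧)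
      ≡⟨ sym (sumOverSubsets-- ys _ _) ⟩
    sumOverSubsets ys (λ s v → -1ℤ ^ s * ⟦ v ≤ c ⟧ - -1ℤ ^ s * ⟦ v ≤ c - y ⟧)
      ≡⟨ sumOverSubsets-cong ys (λ s v → factor (-1ℤ ^ s) _ _) ⟩
    sumOverSubsets ys (window c y)
      ∎
    where
    open ≡-Reasoning
    factor : ∀ a x z → a * x - a * z ≡ a * (x - z)
    factor = solve-∀

  kronecker : ℕ → ℕ → ℤ
  kronecker zero    zero    = 1ℤ
  kronecker zero    (suc _) = 0ℤ
  kronecker (suc _) zero    = 0ℤ
  kronecker (suc s) (suc h) = kronecker s h

  kronecker-refl : ∀ h → kronecker h h ≡ 1ℤ
  kronecker-refl zero    = refl
  kronecker-refl (suc h) = kronecker-refl h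

  kronecker-≢ : ∀ {s h} → s ≢ h → kronecker s h ≡ 0ℤ
  kronecker-≢ {zero}  {zero}  s≢h = contradiction refl s≢h
  kronecker-≢ {zero}  {suc h} _   = refl
  kronecker-≢ {suc s} {zero}  _   = refl
  kronecker-≢ {suc s} {suc h} s≢h = kronecker-≢ (s≢h ∘ cong suc)

  sumOverSubsets-zero : ∀ ws → sumOverSubsets ws (λ _ _ → 0ℤ) ≡ 0ℤ
  sumOverSubsets-zero []       = refl
  sumOverSubsets-zero (w ∷ ws) = cong₂ _+_ (sumOverSubsets-zero ws) (sumOverSubsets-zero ws)

  sumOverSubsets-kronecker : ∀ ws h → sumOverSubsets ws (λ s _ → kronecker s h) ≡ + (length ws C h)
  sumOverSubsets-kronecker []       zero    = refl
  sumOverSubsets-kronecker []       (suc h) = refl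
  sumOverSubsets-kronecker (w ∷ ws) zero    =
    trans (cong₂ _+_ (sumOverSubsets-kronecker ws 0) (sumOverSubsets-zero ws)) (ℤP.+-identityʳ _)
  sumOverSubsets-kronecker (w ∷ ws) (suc h) =
    trans (cong₂ _+_ (sumOverSubsets-kronecker ws (suc h)) (sumOverSubsets-kronecker ws h))
          (trans (sym (ℤP.pos-+ (length ws C suc h) (length ws C h)))
                 (cong +_ (trans (ℕP.+-comm (length ws C suc h) _) (nCk+nC[k+1]≡[n+1]C[k+1] (length ws) h))))

  -- A chain S₁ ⊂ S₂ ⊂ ⋯ ⊂ Sₜ of subsets with |Sᵢ₊₁| = |Sᵢ| + 1, recorded as |S₁| and the list Σ Sₜ, …, Σ S₁.
  Chain : Set
  Chain = ℕ × List ℤ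

  chainSum : Chain → (ℕ → ℤ → ℤ) → ℤ
  chainSum (b , [])     g = 0ℤ
  chainSum (b , v ∷ vs) g = g (b ℕ.+ length vs) v + chainSum (b , vs) g

  sumChains : List Chain → (ℕ → ℤ → ℤ) → ℤ
  sumChains []         g = 0ℤ
  sumChains (ch ∷ chs) g = chainSum ch g + sumChains chs g

  -- The de Bruijn–Tengbergen–Kruyswijk step: a chain S₁ ⊂ ⋯ ⊂ Sₜ of subsets of ws gives the chains
  -- S₁ ⊂ ⋯ ⊂ Sₜ ⊂ Sₜ ∪ {w} and S₁ ∪ {w} ⊂ ⋯ ⊂ Sₜ₋₁ ∪ {w} of subsets of w ∷ ws.
  extend : ℤ → Chain → List Chain
  extend w (b , [])         = []
  extend w (b , v ∷ [])     = (b , v + w ∷ v ∷ []) ∷ []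
  extend w (b , v ∷ u ∷ us) = (b , v + w ∷ v ∷ u ∷ us) ∷ (suc b , map (_+ w) (u ∷ us)) ∷ []

  symmetricChains : List ℤ → List Chain
  symmetricChains []       = (0 , 0ℤ ∷ []) ∷ []
  symmetricChains (w ∷ ws) = concatMap (extend w) (symmetricChains ws)

  sumChains-++ : ∀ chs chs′ g → sumChains (chs ++ chs′) g ≡ sumChains chs g + sumChains chs′ g
  sumChains-++ []         chs′ g = sym (ℤP.+-identityˡ _)
  sumChains-++ (ch ∷ chs) chs′ g =
    trans (cong (λ z → chainSum ch g + z) (sumChains-++ chs chs′ g)) (sym (ℤP.+-assoc (chainSum ch g) _ _))

  chainSum-translate : ∀ b vs w g →
    chainSum (b , vs) (λ s v → g (suc s) (v + w)) ≡ chainSum (suc b , map (_+ w) vs) g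
  chainSum-translate b []       w g = refl
  chainSum-translate b (v ∷ vs) w g =
    cong₂ _+_ (cong (λ l → g (suc (b ℕ.+ l)) (v + w)) (sym (length-map (_+ w) vs))) (chainSum-translate b vs w g)

  sumChains-extend : ∀ w ch g →
    sumChains (extend w ch) g ≡ chainSum ch g + chainSum ch (λ s v → g (suc s) (v + w))
  sumChains-extend w (b , [])         g = refl
  sumChains-extend w (b , v ∷ [])     g =
    trans (cong (λ i → g i (v + w) + (g (b ℕ.+ 0) v + 0ℤ) + 0ℤ) (ℕP.+-suc b 0))
          (regroup (g (suc (b ℕ.+ 0)) (v + w)) (g (b ℕ.+ 0) v))
    where
    regroup : ∀ x y → x + (y + 0ℤ) + 0ℤ ≡ y + 0ℤ + (x + 0ℤ)
    regroup = solve-∀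
  sumChains-extend w (b , v ∷ u ∷ us) g = begin
    g (b ℕ.+ suc L) (v + w) + T + (chainSum (suc b , map (_+ w) (u ∷ us)) g + 0ℤ)
      ≡⟨ cong₂ (λ i z → g i (v + w) + T + (z + 0ℤ)) (ℕP.+-suc b L) (sym (chainSum-translate b (u ∷ us) w g)) ⟩
    g (suc (b ℕ.+ L)) (v + w) + T + (T′ + 0ℤ)
      ≡⟨ regroup (g (suc (b ℕ.+ L)) (v + w)) T T′ ⟩
    T + (g (suc (b ℕ.+ L)) (v + w) + T′)
      ∎
    where
    open ≡-Reasoning
    L = length (u ∷ us)
    T = chainSum (b , v ∷ u ∷ us) g
    T′ = chainSum (b , u ∷ us) (λ s v → g (suc s) (v + w))
    regroup : ∀ x y z → x + y + (z + 0ℤ) ≡ y + (x + z)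
    regroup = solve-∀

  sumChains-concatMap-extend : ∀ w chs g →
    sumChains (concatMap (extend w) chs) g ≡ sumChains chs g + sumChains chs (λ s v → g (suc s) (v + w))
  sumChains-concatMap-extend w []         g = refl
  sumChains-concatMap-extend w (ch ∷ chs) g = begin
    sumChains (extend w ch ++ concatMap (extend w) chs) g
      ≡⟨ sumChains-++ (extend w ch) _ g ⟩
    sumChains (extend w ch) g + sumChains (concatMap (extend w) chs) g
      ≡⟨ cong₂ _+_ (sumChains-extend w ch g) (sumChains-concatMap-extend w chs g) ⟩
    (chainSum ch g + chainSum ch g′) + (sumChains chs g + sumChains chs g′)
      ≡⟨ interchange (chainSum ch g) (chainSum ch g′) (sumChains chs g) (sumChains chs g′) ⟩
    (chainSum ch g + sumChains chs g) + (chainSum ch g′ + sumChains chs g′)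
      ∎
    where
    open ≡-Reasoning
    g′ : ℕ → ℤ → ℤ
    g′ s v = g (suc s) (v + w)
    interchange : ∀ a b e d → a + b + (e + d) ≡ a + e + (b + d)
    interchange = solve-∀

  sumOverSubsets-symmetricChains : ∀ ws g → sumOverSubsets ws g ≡ sumChains (symmetricChains ws) g
  sumOverSubsets-symmetricChains []       g = sym (trans (ℤP.+-identityʳ _) (ℤP.+-identityʳ _))
  sumOverSubsets-symmetricChains (w ∷ ws) g =
    trans (cong₂ _+_ (sumOverSubsets-symmetricChains ws g) (sumOverSubsets-symmetricChains ws _))
          (sym (sumChains-concatMap-extend w (symmetricChains ws) g))

  Symmetric : ℕ → Chain → Set
  Symmetric M (b , [])     = ⊥
  Symmetric M (b , _ ∷ vs) = b ℕ.+ (b ℕ.+ length vs) ≡ M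

  record Gap (y v u : ℤ) : Set where
    constructor gap
    field u+y≤v : u + y ≤ v

  Gapped : ℤ → Chain → Set
  Gapped y (_ , vs) = Linked (Gap y) vs

  extend-symmetric : ∀ w {M} ch → Symmetric M ch → All (Symmetric (suc M)) (extend w ch)
  extend-symmetric w (b , v ∷ [])     refl = trans (cong (b ℕ.+_) (ℕP.+-suc b 0)) (ℕP.+-suc b _) ∷ []
  extend-symmetric w (b , v ∷ u ∷ us) refl =
    trans (cong (b ℕ.+_) (ℕP.+-suc b (suc (length us)))) (ℕP.+-suc b _) ∷
    cong suc (trans (cong (λ l → b ℕ.+ suc (b ℕ.+ l)) (length-map (_+ w) us))
                    (cong (b ℕ.+_) (sym (ℕP.+-suc b (length us))))) ∷ []

  symmetricChains-symmetric : ∀ ws → All (Symmetric (length ws)) (symmetricChains ws)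
  symmetricChains-symmetric []       = refl ∷ []
  symmetricChains-symmetric (w ∷ ws) =
    AllP.concat⁺ (AllP.map⁺ (All.map (λ {ch} → extend-symmetric w ch) (symmetricChains-symmetric ws)))

  extend-gapped : ∀ {y w} → y ≤ w → ∀ ch → Gapped y ch → All (Gapped y) (extend w ch)
  extend-gapped {y} {w} y≤w (b , [])         l = []
  extend-gapped {y} {w} y≤w (b , v ∷ [])     l = (gap (ℤP.+-monoʳ-≤ v y≤w) ∷ [-]) ∷ []
  extend-gapped {y} {w} y≤w (b , v ∷ u ∷ us) l =
    (gap (ℤP.+-monoʳ-≤ v y≤w) ∷ l) ∷ map⁺ (Linked.map translate (Linked.tail l)) ∷ []
    where
    translate : ∀ {v u} → Gap y v u → Gap y (v + w) (u + w)
    translate {v} {u} (gap u+y≤v) = gap (subst (_≤ v + w) (swap-+ u y w) (ℤP.+-monoˡ-≤ w u+y≤v))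
      where
      swap-+ : ∀ u y w → u + y + w ≡ u + w + y
      swap-+ = solve-∀

  symmetricChains-gapped : ∀ {y} ws → All (y ≤_) ws → All (Gapped y) (symmetricChains ws)
  symmetricChains-gapped []       []            = [-] ∷ []
  symmetricChains-gapped (w ∷ ws) (y≤w ∷ y≤ws) =
    AllP.concat⁺ (AllP.map⁺ (All.map (λ {ch} → extend-gapped y≤w ch) (symmetricChains-gapped ws y≤ws)))

  ≤-+-nonNeg : ∀ {y} i → 0ℤ ≤ y → i ≤ i + y
  ≤-+-nonNeg i 0≤y = subst (_≤ i + _) (ℤP.+-identityʳ i) (ℤP.+-monoʳ-≤ i 0≤y)

  Gap-trans : ∀ {y} → 0ℤ ≤ y → Transitive (Gap y)
  Gap-trans 0≤y {j = j} (gap j+y≤i) (gap k+y≤j) = gap (ℤP.≤-trans k+y≤j (ℤP.≤-trans (≤-+-nonNeg j 0≤y) j+y≤i))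

  ∣-1^s*i∣ : ∀ s i → ∣ -1ℤ ^ s * i ∣ ≡ ∣ i ∣
  ∣-1^s*i∣ zero    i = cong ∣_∣ (ℤP.*-identityˡ i)
  ∣-1^s*i∣ (suc s) i = begin
    ∣ -1ℤ * -1ℤ ^ s * i ∣      ≡⟨ cong ∣_∣ (ℤP.*-assoc -1ℤ (-1ℤ ^ s) i) ⟩
    ∣ -1ℤ * (-1ℤ ^ s * i) ∣    ≡⟨ cong ∣_∣ (ℤP.-1*i≡-i (-1ℤ ^ s * i)) ⟩
    ∣ - (-1ℤ ^ s * i) ∣        ≡⟨ ℤP.∣-i∣≡∣i∣ (-1ℤ ^ s * i) ⟩
    ∣ -1ℤ ^ s * i ∣            ≡⟨ ∣-1^s*i∣ s i ⟩
    ∣ i ∣                      ∎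
    where open ≡-Reasoning

  ∣⟦≤⟧∣≤1 : ∀ x y → ∣ ⟦ x ≤ y ⟧ ∣ ℕ.≤ 1
  ∣⟦≤⟧∣≤1 x y with x ℤP.≤? y
  ... | yes _ = ℕP.≤-refl
  ... | no  _ = z≤n

  window-below : ∀ {y u} c s → 0ℤ ≤ y → u + y ≤ c → window c y s u ≡ 0ℤ
  window-below {y} {u} c s 0≤y u+y≤c = begin
    -1ℤ ^ s * (⟦ u ≤ c ⟧ - ⟦ u ≤ c - y ⟧)  ≡⟨ cong₂ (λ a b → -1ℤ ^ s * (a - b)) (⟦≤⟧-true u≤c) (⟦≤⟧-true u≤c-y) ⟩
    -1ℤ ^ s * 0ℤ                           ≡⟨ ℤP.*-zeroʳ (-1ℤ ^ s) ⟩
    0ℤ                                     ∎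
    where
    open ≡-Reasoning
    u≤c : u ≤ c
    u≤c = ℤP.≤-trans (≤-+-nonNeg u 0≤y) u+y≤c
    u≤c-y : u ≤ c - y
    u≤c-y = subst (_≤ c - y) (cancel u y) (ℤP.+-monoˡ-≤ (- y) u+y≤c)
      where
      cancel : ∀ u y → u + y - y ≡ u
      cancel = solve-∀

  window-above : ∀ {y u} c s → 0ℤ ≤ y → ¬ u ≤ c → window c y s u ≡ 0ℤ
  window-above {y} {u} c s 0≤y u≰c = begin
    -1ℤ ^ s * (⟦ u ≤ c ⟧ - ⟦ u ≤ c - y ⟧)  ≡⟨ cong₂ (λ a b → -1ℤ ^ s * (a - b)) (⟦≤⟧-false u≰c) (⟦≤⟧-false u≰c-y) ⟩
    -1ℤ ^ s * 0ℤ                           ≡⟨ ℤP.*-zeroʳ (-1ℤ ^ s) ⟩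
    0ℤ                                     ∎
    where
    open ≡-Reasoning
    u≰c-y : ¬ u ≤ c - y
    u≰c-y u≤c-y = u≰c (ℤP.≤-trans u≤c-y (subst (c - y ≤_) (cancel c y) (≤-+-nonNeg (c - y) 0≤y)))
      where
      cancel : ∀ c y → c - y + y ≡ c
      cancel = solve-∀

  ∣1-⟦≤⟧∣≤1 : ∀ x y → ∣ 1ℤ - ⟦ x ≤ y ⟧ ∣ ℕ.≤ 1
  ∣1-⟦≤⟧∣≤1 x y with x ℤP.≤? y
  ... | yes _ = z≤n
  ... | no  _ = ℕP.≤-refl

  Gapped-head : ∀ {y v vs} → 0ℤ ≤ y → Linked (Gap y) (v ∷ vs) → All (Gap y v) vs
  Gapped-head 0≤y [-]       = []
  Gapped-head 0≤y (g ∷ gs) = Linked⇒All (Gap-trans 0≤y) g gs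

  chainSum-zero : ∀ {g} b {vs} → All (λ u → ∀ s → g s u ≡ 0ℤ) vs → chainSum (b , vs) g ≡ 0ℤ
  chainSum-zero b []         = refl
  chainSum-zero b (z ∷ zs) = cong₂ _+_ (z _) (chainSum-zero b zs)

  -- Consecutive sums along a chain differ by at least y, so at most one of them lies in the window (c - y, c].
  chainSum-window : ∀ {y} c → 0ℤ ≤ y → ∀ b vs → Gapped y (b , vs) → ∣ chainSum (b , vs) (window c y) ∣ ℕ.≤ 1
  chainSum-window c 0≤y b []       _ = z≤n
  chainSum-window {y} c 0≤y b (v ∷ vs) l = bound (v ℤP.≤? c)
    where
    open ℕP.≤-Reasoning
    i = b ℕ.+ length vs
    bound : Dec (v ≤ c) → ∣ window c y i v + chainSum (b , vs) (window c y) ∣ ℕ.≤ 1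
    bound (yes v≤c) = begin
      ∣ window c y i v + chainSum (b , vs) (window c y) ∣
        ≡⟨ cong (λ z → ∣ window c y i v + z ∣) (chainSum-zero {window c y} b (All.map below (Gapped-head 0≤y l))) ⟩
      ∣ window c y i v + 0ℤ ∣       ≡⟨ cong ∣_∣ (ℤP.+-identityʳ (window c y i v)) ⟩
      ∣ window c y i v ∣            ≡⟨ ∣-1^s*i∣ i (⟦ v ≤ c ⟧ - ⟦ v ≤ c - y ⟧) ⟩
      ∣ ⟦ v ≤ c ⟧ - ⟦ v ≤ c - y ⟧ ∣ ≡⟨ cong (λ z → ∣ z - ⟦ v ≤ c - y ⟧ ∣) (⟦≤⟧-true v≤c) ⟩
      ∣ 1ℤ - ⟦ v ≤ c - y ⟧ ∣        ≤⟨ ∣1-⟦≤⟧∣≤1 v (c - y) ⟩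
      1                             ∎
      where
      below : ∀ {u} → Gap y v u → ∀ s → window c y s u ≡ 0ℤ
      below {u} (gap u+y≤v) s = window-below {u = u} c s 0≤y (ℤP.≤-trans u+y≤v v≤c)
    bound (no v≰c) = begin
      ∣ window c y i v + chainSum (b , vs) (window c y) ∣
        ≡⟨ cong (λ z → ∣ z + chainSum (b , vs) (window c y) ∣) (window-above c i 0≤y v≰c) ⟩
      ∣ 0ℤ + chainSum (b , vs) (window c y) ∣  ≡⟨ cong ∣_∣ (ℤP.+-identityˡ (chainSum (b , vs) (window c y))) ⟩
      ∣ chainSum (b , vs) (window c y) ∣       ≤⟨ chainSum-window c 0≤y b vs (Linked.tail l) ⟩
      1                                        ∎

  chainSum-kronecker-above : ∀ b vs {h} → b ℕ.+ length vs ℕ.≤ h → chainSum (b , vs) (λ s _ → kronecker s h) ≡ 0ℤ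
  chainSum-kronecker-above b []           _      = refl
  chainSum-kronecker-above b (v ∷ vs) {h} b+l≤h =
    trans (cong₂ _+_ (kronecker-≢ (ℕP.<⇒≢ i<h)) (chainSum-kronecker-above b vs (ℕP.<⇒≤ i<h))) (ℤP.+-identityˡ 0ℤ)
    where
    i<h : b ℕ.+ length vs ℕ.< h
    i<h = subst (ℕ._≤ h) (ℕP.+-suc b (length vs)) b+l≤h

  chainSum-kronecker : ∀ b vs {h} → b ℕ.≤ h → h ℕ.< b ℕ.+ length vs → chainSum (b , vs) (λ s _ → kronecker s h) ≡ 1ℤ
  chainSum-kronecker b []           b≤h h<b+0 =
    contradiction (subst (_ ℕ.<_) (ℕP.+-identityʳ b) h<b+0) (ℕP.≤⇒≯ b≤h)
  chainSum-kronecker b (v ∷ vs) {h} b≤h h<b+l with b ℕ.+ length vs ℕP.≟ h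
  ... | yes refl = trans (cong₂ _+_ (kronecker-refl (b ℕ.+ length vs)) (chainSum-kronecker-above b vs ℕP.≤-refl))
                         (ℤP.+-identityʳ 1ℤ)
  ... | no  i≢h  = trans (cong₂ _+_ (kronecker-≢ i≢h) (chainSum-kronecker b vs b≤h h<i)) (ℤP.+-identityˡ 1ℤ)
    where
    h<i : h ℕ.< b ℕ.+ length vs
    h<i = ℕP.≤∧≢⇒< (ℕP.≤-pred (subst (h ℕ.<_) (ℕP.+-suc b (length vs)) h<b+l)) (i≢h ∘ sym)

  symmetric-middle : ∀ b L → b ℕ.≤ (b ℕ.+ (b ℕ.+ L)) / 2 × (b ℕ.+ (b ℕ.+ L)) / 2 ℕ.< b ℕ.+ suc L
  symmetric-middle b L =
    subst (ℕ._≤ M / 2) (m*n/n≡m b 2) (/-monoˡ-≤ 2 (subst (ℕ._≤ M) (sym (double b)) 2b≤M)) ,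
    m<n*o⇒m/o<n (subst (M ℕ.<_) (sym (double+ b L)) (ℕP.m≤m+n (suc M) (suc L)))
    where
    M = b ℕ.+ (b ℕ.+ L)
    2b≤M : b ℕ.+ (b ℕ.+ 0) ℕ.≤ M
    2b≤M = ℕP.+-monoʳ-≤ b (ℕP.+-monoʳ-≤ b z≤n)
    double : ∀ b → b ℕ.* 2 ≡ b ℕ.+ (b ℕ.+ 0)
    double = ℕ-Solver.solve-∀
    double+ : ∀ b L → (b ℕ.+ suc L) ℕ.* 2 ≡ suc (b ℕ.+ (b ℕ.+ L)) ℕ.+ suc L
    double+ = ℕ-Solver.solve-∀

  chainSum-middle : ∀ {M} ch → Symmetric M ch → chainSum ch (λ s _ → kronecker s (M / 2)) ≡ 1ℤ
  chainSum-middle (b , v ∷ vs) refl =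
    let b≤h , h<top = symmetric-middle b (length vs)
    in  chainSum-kronecker b (v ∷ vs) b≤h h<top

  sumChains-ones : ∀ {g} chs → All (λ ch → chainSum ch g ≡ 1ℤ) chs → sumChains chs g ≡ + length chs
  sumChains-ones []         []       = refl
  sumChains-ones (ch ∷ chs) (e ∷ es) = trans (cong₂ _+_ e (sumChains-ones chs es)) (sym (ℤP.pos-+ 1 (length chs)))

  length-symmetricChains : ∀ ws → length (symmetricChains ws) ≡ length ws C (length ws / 2)
  length-symmetricChains ws = ℤP.+-injective (begin
    + length (symmetricChains ws)
      ≡⟨ sumChains-ones _ (All.map (λ {ch} → chainSum-middle ch) (symmetricChains-symmetric ws)) ⟨
    sumChains (symmetricChains ws) level
      ≡⟨ sumOverSubsets-symmetricChains ws level ⟨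
    sumOverSubsets ws level
      ≡⟨ sumOverSubsets-kronecker ws (length ws / 2) ⟩
    + (length ws C (length ws / 2))
      ∎)
    where
    open ≡-Reasoning
    level : ℕ → ℤ → ℤ
    level s _ = kronecker s (length ws / 2)

  ∣sumChains∣≤length : ∀ {g} chs → All (λ ch → ∣ chainSum ch g ∣ ℕ.≤ 1) chs → ∣ sumChains chs g ∣ ℕ.≤ length chs
  ∣sumChains∣≤length []         []       = z≤n
  ∣sumChains∣≤length (ch ∷ chs) (b ∷ bs) =
    ℕP.≤-trans (ℤP.∣i+j∣≤∣i∣+∣j∣ (chainSum ch _) _) (ℕP.+-mono-≤ b (∣sumChains∣≤length chs bs))

  -- Each of the (length ys) C (length ys / 2) symmetric chains contributes at most one term to the window.
  window-bound : ∀ y ys c → 0ℤ ≤ y → All (y ≤_) ys → ∣ signedCount (y ∷ ys) c ∣ ℕ.≤ length ys C (length ys / 2)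
  window-bound y ys c 0≤y y≤ys = begin
    ∣ signedCount (y ∷ ys) c ∣
      ≡⟨ cong ∣_∣ (trans (signedCount-window y ys c) (sumOverSubsets-symmetricChains ys (window c y))) ⟩
    ∣ sumChains (symmetricChains ys) (window c y) ∣
      ≤⟨ ∣sumChains∣≤length _ (All.map (λ {(b , vs)} → chainSum-window c 0≤y b vs) (symmetricChains-gapped ys y≤ys)) ⟩
    length (symmetricChains ys)
      ≡⟨ length-symmetricChains ys ⟩
    length ys C (length ys / 2)
      ∎
    where open ℕP.≤-Reasoning

  sorted-bound : ∀ vs → Linked _≤_ vs → All (0ℤ ≤_) vs → ∀ c →
                 ∣ signedCount vs c ∣ ℕ.≤ (length vs ∸ 1) C ((length vs ∸ 1) / 2)
  sorted-bound []       _      _           c = ∣⟦≤⟧∣≤1 0ℤ c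
  sorted-bound (y ∷ ys) sorted (0≤y ∷ _) c = window-bound y ys c 0≤y (minimum sorted)
    where
    minimum : ∀ {y ys} → Linked _≤_ (y ∷ ys) → All (y ≤_) ys
    minimum [-]       = []
    minimum (y≤ ∷ l) = Linked⇒All ℤP.≤-trans y≤ l

  -- Negating or permuting the weights only changes signedCount by a sign and a translation,
  -- so the weights may be taken nonnegative and sorted, the smallest first.
  signedCount-bound : ∀ ws c → ∣ signedCount ws c ∣ ℕ.≤ (length ws ∸ 1) C ((length ws ∸ 1) / 2)
  signedCount-bound ws c = begin
    ∣ signedCount ws c ∣             ≡⟨ eq c ⟩
    ∣ signedCount sorted (c + d) ∣   ≤⟨ sorted-bound sorted (sort-↗ vs) nonNeg (c + d) ⟩
    bound (length sorted)            ≡⟨ cong bound sameLength ⟩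
    bound (length ws)                ∎
    where
    open ℕP.≤-Reasoning
    bound : ℕ → ℕ
    bound l = (l ∸ 1) C ((l ∸ 1) / 2)
    vs = map (+_ ∘ ∣_∣) ws
    sorted = sort vs
    related : ws ≈ sorted
    related = ≈-trans (≈-absWeights ws) (≈-↭ (↭-sym (sort-↭ vs)))
    d = proj₁ (≈-∣signedCount∣ related)
    eq = proj₂ (≈-∣signedCount∣ related)
    nonNeg : All (0ℤ ≤_) sorted
    nonNeg = All-resp-↭ (↭-sym (sort-↭ vs)) (AllP.map⁺ (All.universal (λ w → ℤ.+≤+ z≤n) ws))
    sameLength : length sorted ≡ length ws
    sameLength = trans (↭-length (sort-↭ vs)) (length-map (+_ ∘ ∣_∣) ws)


module Sequences where

  open import Defs
  open import Data.Nat as ℕ using (ℕ; zero; suc; _∸_; z≤n; s≤s)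
  import Data.Nat.Properties as ℕP
  open import Data.Nat.Induction using (<-rec)
  open import Data.Integer as ℤ using (ℤ; +_; -[1+_]; 0ℤ; 1ℤ; _+_; _-_; -_; _*_; _<_)
  import Data.Integer.Properties as ℤP
  open import Data.Integer.Tactic.RingSolver using (solve-∀)
  open import Data.Fin as Fin using (Fin)
  open import Function using (_∘_; id)
  open import Relation.Nullary using (yes; no; contradiction)
  open import Relation.Binary.PropositionalEquality

  sumTo-cong : ∀ t {g h : ℕ → ℤ} → (∀ i → i ℕ.≤ t → g i ≡ h i) → sumTo t g ≡ sumTo t h
  sumTo-cong zero    eq = eq 0 z≤n
  sumTo-cong (suc t) eq = cong₂ _+_ (sumTo-cong t (λ i i≤t → eq i (ℕP.m≤n⇒m≤1+n i≤t))) (eq (suc t) ℕP.≤-refl)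

  sumTo-- : ∀ t (g h : ℕ → ℤ) → sumTo t (λ i → g i - h i) ≡ sumTo t g - sumTo t h
  sumTo-- zero    g h = refl
  sumTo-- (suc t) g h = trans (cong (_+ (g (suc t) - h (suc t))) (sumTo-- t g h))
                              (interchange (sumTo t g) (sumTo t h) (g (suc t)) (h (suc t)))
    where
    interchange : ∀ a b c d → a - b + (c - d) ≡ a + c - (b + d)
    interchange = solve-∀

  sumTo-zero : ∀ t (h : ℕ → ℤ) → (∀ i → i ℕ.≤ t → h i ≡ 0ℤ) → sumTo t h ≡ 0ℤ
  sumTo-zero zero    h z = z 0 z≤n
  sumTo-zero (suc t) h z = cong₂ _+_ (sumTo-zero t h (λ i i≤t → z i (ℕP.m≤n⇒m≤1+n i≤t))) (z (suc t) ℕP.≤-refl)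

  sumTo-single : ∀ t j (h : ℕ → ℤ) → j ℕ.≤ t → (∀ i → i ℕ.≤ t → i ≢ j → h i ≡ 0ℤ) → sumTo t h ≡ h j
  sumTo-single zero    zero h _ _ = refl
  sumTo-single (suc t) j h j≤t z with j ℕP.≟ suc t
  ... | yes refl = trans (cong (_+ h (suc t)) (sumTo-zero t h (λ i i≤t → z i (ℕP.m≤n⇒m≤1+n i≤t) (ℕP.<⇒≢ (s≤s i≤t)))))
                         (ℤP.+-identityˡ _)
  ... | no  j≢t  = trans (cong₂ _+_ (sumTo-single t j h (ℕP.≤-pred (ℕP.≤∧≢⇒< j≤t j≢t)) (λ i i≤t → z i (ℕP.m≤n⇒m≤1+n i≤t)))
                                    (z (suc t) ℕP.≤-refl (j≢t ∘ sym)))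
                         (ℤP.+-identityʳ _)

  sumTo-shift : ∀ a s (h : ℕ → ℤ) → (∀ i → i ℕ.< a → h i ≡ 0ℤ) → sumTo (s ℕ.+ a) h ≡ sumTo s (λ j → h (j ℕ.+ a))
  sumTo-shift a zero    h z = sumTo-single a a h ℕP.≤-refl (λ i i≤a i≢a → z i (ℕP.≤∧≢⇒< i≤a i≢a))
  sumTo-shift a (suc s) h z = cong (_+ h (suc (s ℕ.+ a))) (sumTo-shift a s h z)

  -- Power series become ℤ-indexed sequences vanishing at negative indices, so that x^b g is simply u ↦ g (u - b).
  Seq : Set
  Seq = ℤ → ℤ

  toSeq : PowerSeries → Seq
  toSeq f (+ n)    = f n
  toSeq f -[1+ n ] = 0ℤ

  Causal : Seq → Set
  Causal g = ∀ {u} → u < 0ℤ → g u ≡ 0ℤ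

  toSeq-causal : ∀ f → Causal (toSeq f)
  toSeq-causal f { -[1+ n ]} _          = refl
  toSeq-causal f {+ n}       (ℤ.+<+ ())

  i<0⇒i-n<0 : ∀ {i} n → i < 0ℤ → i - + n < 0ℤ
  i<0⇒i-n<0 {i} n i<0 = ℤP.≤-<-trans (ℤP.i-j≤i i (+ n)) i<0

  i<j⇒i-j<0 : ∀ {i j} → i < j → i - j < 0ℤ
  i<j⇒i-j<0 {i} {j} i<j = ℤP.<-≤-trans (ℤP.+-monoˡ-< (- j) i<j) (ℤP.≤-reflexive (ℤP.+-inverseʳ j))

  +m-+n≡+[m∸n] : ∀ {m n} → n ℕ.≤ m → + m - + n ≡ + (m ∸ n)
  +m-+n≡+[m∸n] {m} {n} n≤m = trans (ℤP.m-n≡m⊖n m n) (ℤP.⊖-≥ n≤m)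

  toSeq-∸ : ∀ f {a t} → a ℕ.≤ t → toSeq f (+ t - + a) ≡ f (t ∸ a)
  toSeq-∸ f a≤t = cong (toSeq f) (+m-+n≡+[m∸n] a≤t)

  toSeq-> : ∀ f {a t} → t ℕ.< a → toSeq f (+ t - + a) ≡ 0ℤ
  toSeq-> f t<a = toSeq-causal f (i<j⇒i-j<0 (ℤ.+<+ t<a))

  X^-≡ : ∀ a → X^ a a ≡ 1ℤ
  X^-≡ a with a ℕP.≟ a
  ... | yes _   = refl
  ... | no  a≢a = contradiction refl a≢a

  X^-≢ : ∀ {a i} → a ≢ i → X^ a i ≡ 0ℤ
  X^-≢ {a} {i} a≢i with a ℕP.≟ i
  ... | yes a≡i = contradiction a≡i a≢i
  ... | no  _   = refl

  sumTo-X^ : ∀ a t (g : PowerSeries) → sumTo t (λ i → X^ a i * g (t ∸ i)) ≡ toSeq g (+ t - + a)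
  sumTo-X^ a t g with a ℕP.≤? t
  ... | yes a≤t = begin
    sumTo t (λ i → X^ a i * g (t ∸ i))  ≡⟨ sumTo-single t a _ a≤t (λ i _ i≢a →
                                             trans (cong (_* g (t ∸ i)) (X^-≢ (i≢a ∘ sym))) (ℤP.*-zeroˡ (g (t ∸ i)))) ⟩
    X^ a a * g (t ∸ a)                  ≡⟨ trans (cong (_* g (t ∸ a)) (X^-≡ a)) (ℤP.*-identityˡ (g (t ∸ a))) ⟩
    g (t ∸ a)                           ≡⟨ toSeq-∸ g a≤t ⟨
    toSeq g (+ t - + a)                 ∎
    where open ≡-Reasoning
  ... | no  a≰t = trans (sumTo-zero t _ (λ i i≤t →
                          trans (cong (_* g (t ∸ i)) (X^-≢ (λ a≡i → a≰t (subst (ℕ._≤ t) (sym a≡i) i≤t))))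
                                (ℤP.*-zeroˡ (g (t ∸ i)))))
                        (sym (toSeq-> g (ℕP.≰⇒> a≰t)))

  *ₛ-identityˡ : ∀ f t → (oneₛ *ₛ f) t ≡ f t
  *ₛ-identityˡ f t = trans (sumTo-X^ 0 t f) (cong (toSeq f) (ℤP.+-identityʳ (+ t)))

  *ₛ-identityʳ : ∀ f t → (f *ₛ oneₛ) t ≡ f t
  *ₛ-identityʳ f t = begin
    sumTo t (λ i → f i * X^ 0 (t ∸ i))  ≡⟨ sumTo-single t t _ ℕP.≤-refl (λ i i≤t i≢t →
                                             trans (cong (f i *_) (X^-≢ (λ 0≡t∸i →
                                                     i≢t (ℕP.≤-antisym i≤t (ℕP.m∸n≡0⇒m≤n (sym 0≡t∸i))))))
                                                   (ℤP.*-zeroʳ (f i))) ⟩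
    f t * X^ 0 (t ∸ t)                  ≡⟨ cong (λ z → f t * X^ 0 z) (ℕP.n∸n≡0 t) ⟩
    f t * 1ℤ                            ≡⟨ ℤP.*-identityʳ (f t) ⟩
    f t                                 ∎
    where open ≡-Reasoning

  *-distribʳ-- : ∀ z x y → (x - y) * z ≡ x * z - y * z
  *-distribʳ-- z x y = distrib x y z
    where
    distrib : ∀ x y z → (x - y) * z ≡ x * z - y * z
    distrib = solve-∀

  toSeq-cong : ∀ {f g} → (∀ t → f t ≡ g t) → toSeq f ≗ toSeq g
  toSeq-cong eq (+ t)    = eq t
  toSeq-cong eq -[1+ n ] = refl

  -- multiplication by 1 - x^b
  diff : ℕ → Seq → Seq
  diff b g u = g u - g (u - + b)

  diff-cong : ∀ b {g h} → g ≗ h → diff b g ≗ diff b h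
  diff-cong b eq u = cong₂ _-_ (eq u) (eq (u - + b))

  oneMinusX^-*ₛ : ∀ a g t → (oneMinusX^ a *ₛ g) t ≡ g t - toSeq g (+ t - + a)
  oneMinusX^-*ₛ a g t = begin
    sumTo t (λ i → (X^ 0 i - X^ a i) * g (t ∸ i))
      ≡⟨ sumTo-cong t (λ i _ → *-distribʳ-- (g (t ∸ i)) (X^ 0 i) (X^ a i)) ⟩
    sumTo t (λ i → X^ 0 i * g (t ∸ i) - X^ a i * g (t ∸ i))
      ≡⟨ sumTo-- t _ _ ⟩
    sumTo t (λ i → X^ 0 i * g (t ∸ i)) - sumTo t (λ i → X^ a i * g (t ∸ i))
      ≡⟨ cong₂ _-_ (*ₛ-identityˡ g t) (sumTo-X^ a t g) ⟩
    g t - toSeq g (+ t - + a)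
      ∎
    where open ≡-Reasoning

  toSeq-oneMinusX^-*ₛ : ∀ a g → toSeq (oneMinusX^ a *ₛ g) ≗ diff a (toSeq g)
  toSeq-oneMinusX^-*ₛ a g (+ t)    = oneMinusX^-*ₛ a g t
  toSeq-oneMinusX^-*ₛ a g -[1+ n ] = sym (cong (λ z → 0ℤ - z) (toSeq-causal g (i<0⇒i-n<0 a ℤ.-<+)))

  delayed-*ₛ : ∀ a B f t → sumTo t (λ i → toSeq B (+ i - + a) * f (t ∸ i)) ≡ toSeq (B *ₛ f) (+ t - + a)
  delayed-*ₛ a B f t with a ℕP.≤? t
  ... | no  a≰t = trans (sumTo-zero t _ (λ i i≤t → trans (cong (_* f (t ∸ i)) (toSeq-> B (ℕP.≤-<-trans i≤t (ℕP.≰⇒> a≰t))))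
                                                          (ℤP.*-zeroˡ (f (t ∸ i)))))
                        (sym (toSeq-> (B *ₛ f) (ℕP.≰⇒> a≰t)))
  ... | yes a≤t = begin
    sumTo t (h t)                       ≡⟨ cong (λ t′ → sumTo t′ (h t′)) (sym (ℕP.m∸n+n≡m a≤t)) ⟩
    sumTo (s ℕ.+ a) (h (s ℕ.+ a))       ≡⟨ sumTo-shift a s (h (s ℕ.+ a)) (λ i i<a →
                                             trans (cong (_* f (s ℕ.+ a ∸ i)) (toSeq-> B i<a))
                                                   (ℤP.*-zeroˡ (f (s ℕ.+ a ∸ i)))) ⟩
    sumTo s (λ j → h (s ℕ.+ a) (j ℕ.+ a)) ≡⟨ sumTo-cong s (λ j _ → cong₂ _*_
                                             (trans (toSeq-∸ B (ℕP.m≤n+m a j)) (cong B (ℕP.m+n∸n≡m j a)))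
                                             (cong f (∸-cancel s j a))) ⟩
    (B *ₛ f) s                          ≡⟨ toSeq-∸ (B *ₛ f) a≤t ⟨
    toSeq (B *ₛ f) (+ t - + a)          ∎
    where
    open ≡-Reasoning
    s = t ∸ a
    h : ℕ → ℕ → ℤ
    h t i = toSeq B (+ i - + a) * f (t ∸ i)
    ∸-cancel : ∀ s j a → s ℕ.+ a ∸ (j ℕ.+ a) ≡ s ∸ j
    ∸-cancel s j a = trans (cong₂ _∸_ (ℕP.+-comm s a) (ℕP.+-comm j a)) (ℕP.[m+n]∸[m+o]≡n∸o a s j)

  *ₛ-assoc-oneMinusX^ : ∀ a B f t → ((oneMinusX^ a *ₛ B) *ₛ f) t ≡ (oneMinusX^ a *ₛ (B *ₛ f)) t
  *ₛ-assoc-oneMinusX^ a B f t = begin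
    sumTo t (λ i → (oneMinusX^ a *ₛ B) i * f (t ∸ i))
      ≡⟨ sumTo-cong t (λ i _ → trans (cong (_* f (t ∸ i)) (oneMinusX^-*ₛ a B i))
                                     (*-distribʳ-- (f (t ∸ i)) (B i) (toSeq B (+ i - + a)))) ⟩
    sumTo t (λ i → B i * f (t ∸ i) - toSeq B (+ i - + a) * f (t ∸ i))
      ≡⟨ sumTo-- t _ _ ⟩
    (B *ₛ f) t - sumTo t (λ i → toSeq B (+ i - + a) * f (t ∸ i))
      ≡⟨ cong (λ z → (B *ₛ f) t - z) (delayed-*ₛ a B f t) ⟩
    (B *ₛ f) t - toSeq (B *ₛ f) (+ t - + a)
      ≡⟨ oneMinusX^-*ₛ a (B *ₛ f) t ⟨
    (oneMinusX^ a *ₛ (B *ₛ f)) t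
      ∎
    where open ≡-Reasoning

  ⨀ : ∀ {k} → (Fin k → Seq → Seq) → Seq → Seq
  ⨀ {zero}  T = id
  ⨀ {suc k} T = T Fin.zero ∘ ⨀ (T ∘ Fin.suc)

  toSeq-∏ₛ-*ₛ : ∀ {k} (b : Fin k → ℕ) f → toSeq (∏ₛ (oneMinusX^ ∘ b) *ₛ f) ≗ ⨀ (diff ∘ b) (toSeq f)
  toSeq-∏ₛ-*ₛ {zero}  b f u = toSeq-cong (*ₛ-identityˡ f) u
  toSeq-∏ₛ-*ₛ {suc k} b f u = begin
    toSeq ((oneMinusX^ (b Fin.zero) *ₛ ∏ₛ (oneMinusX^ ∘ b ∘ Fin.suc)) *ₛ f) u
      ≡⟨ toSeq-cong (*ₛ-assoc-oneMinusX^ (b Fin.zero) (∏ₛ (oneMinusX^ ∘ b ∘ Fin.suc)) f) u ⟩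
    toSeq (oneMinusX^ (b Fin.zero) *ₛ (∏ₛ (oneMinusX^ ∘ b ∘ Fin.suc) *ₛ f)) u
      ≡⟨ toSeq-oneMinusX^-*ₛ (b Fin.zero) _ u ⟩
    diff (b Fin.zero) (toSeq (∏ₛ (oneMinusX^ ∘ b ∘ Fin.suc) *ₛ f)) u
      ≡⟨ diff-cong (b Fin.zero) (toSeq-∏ₛ-*ₛ (b ∘ Fin.suc) f) u ⟩
    ⨀ (diff ∘ b) (toSeq f) u
      ∎
    where open ≡-Reasoning

  AgreeBelow : ℕ → Seq → Seq → Set
  AgreeBelow n g h = ∀ u → u < + n → g u ≡ h u

  ≗⇒AgreeBelow : ∀ {n g h} → g ≗ h → AgreeBelow n g h
  ≗⇒AgreeBelow eq u _ = eq u

  AgreeBelow-trans : ∀ {n f g h} → AgreeBelow n f g → AgreeBelow n g h → AgreeBelow n f h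
  AgreeBelow-trans p q u u<n = trans (p u u<n) (q u u<n)

  AgreeBelow-sym : ∀ {n g h} → AgreeBelow n g h → AgreeBelow n h g
  AgreeBelow-sym p u u<n = sym (p u u<n)

  -- Operators acting like multiplication by a polynomial: combinations of shifts by nonnegative amounts.
  record IsShiftOperator (T : Seq → Seq) : Set where
    field
      ≗-cong    : ∀ {g h} → g ≗ h → T g ≗ T h
      agree     : ∀ {n g h} → AgreeBelow n g h → AgreeBelow n (T g) (T h)
      causal    : ∀ {g} → Causal g → Causal (T g)
      diff-comm : ∀ b g → T (diff b g) ≗ diff b (T g)

  diff-isShiftOperator : ∀ c → IsShiftOperator (diff c)
  diff-isShiftOperator c = record
    { ≗-cong    = diff-cong c
    ; agree     = λ eq u u<n → cong₂ _-_ (eq u u<n) (eq (u - + c) (ℤP.≤-<-trans (ℤP.i-j≤i u (+ c)) u<n))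
    ; causal    = λ cg u<0 → cong₂ _-_ (cg u<0) (cg (i<0⇒i-n<0 c u<0))
    ; diff-comm = λ b g u → trans (cong (λ v → g u - g (u - + b) - (g (u - + c) - g v)) (swap-− u (+ c) (+ b)))
                                  (regroup (g u) (g (u - + b)) (g (u - + c)) (g (u - + b - + c)))
    }
    where
    swap-− : ∀ u c b → u - c - b ≡ u - b - c
    swap-− = solve-∀
    regroup : ∀ x y z w → x - y - (z - w) ≡ x - z - (y - w)
    regroup = solve-∀

  -- multiplication by 1 + x^c + x^2c + ⋯ + x^Fc
  geom : ℕ → ℕ → Seq → Seq
  geom F c g u = sumTo F (λ j → g (u - + (j ℕ.* c)))

  geom-isShiftOperator : ∀ F c → IsShiftOperator (geom F c)
  geom-isShiftOperator F c = record
    { ≗-cong    = λ eq u → sumTo-cong F (λ j _ → eq _)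
    ; agree     = λ eq u u<n → sumTo-cong F (λ j _ → eq _ (ℤP.≤-<-trans (ℤP.i-j≤i u _) u<n))
    ; causal    = λ cg u<0 → sumTo-zero F _ (λ j _ → cg (i<0⇒i-n<0 (j ℕ.* c) u<0))
    ; diff-comm = λ b g u → trans (sumTo-- F _ _)
                                  (cong (λ z → geom F c g u - z)
                                        (sumTo-cong F (λ j _ → cong g (swap-− u (+ (j ℕ.* c)) (+ b)))))
    }
    where
    swap-− : ∀ u c b → u - c - b ≡ u - b - c
    swap-− = solve-∀

  ∘-isShiftOperator : ∀ {S T} → IsShiftOperator S → IsShiftOperator T → IsShiftOperator (S ∘ T)
  ∘-isShiftOperator S T = record
    { ≗-cong    = S.≗-cong ∘ T.≗-cong
    ; agree     = S.agree ∘ T.agree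
    ; causal    = S.causal ∘ T.causal
    ; diff-comm = λ b g u → trans (S.≗-cong (T.diff-comm b g) u) (S.diff-comm b _ u)
    }
    where
    module S = IsShiftOperator S
    module T = IsShiftOperator T

  ⨀-isShiftOperator : ∀ {k} {T : Fin k → Seq → Seq} → (∀ i → IsShiftOperator (T i)) → IsShiftOperator (⨀ T)
  ⨀-isShiftOperator {zero}  _     = record { ≗-cong = id ; agree = id ; causal = id ; diff-comm = λ _ _ _ → refl }
  ⨀-isShiftOperator {suc k} isOp = ∘-isShiftOperator (isOp Fin.zero) (⨀-isShiftOperator (isOp ∘ Fin.suc))

  sumTo-telescope : ∀ F (h : ℕ → ℤ) → sumTo F h - sumTo F (h ∘ suc) ≡ h 0 - h (suc F)
  sumTo-telescope zero    h = refl
  sumTo-telescope (suc F) h = begin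
    sumTo F h + h (suc F) - (sumTo F (h ∘ suc) + h (suc (suc F)))
      ≡⟨ regroup (sumTo F h) (sumTo F (h ∘ suc)) (h (suc F)) (h (suc (suc F))) ⟩
    (sumTo F h - sumTo F (h ∘ suc)) + (h (suc F) - h (suc (suc F)))
      ≡⟨ cong (_+ (h (suc F) - h (suc (suc F)))) (sumTo-telescope F h) ⟩
    (h 0 - h (suc F)) + (h (suc F) - h (suc (suc F)))
      ≡⟨ collapse (h 0) (h (suc F)) (h (suc (suc F))) ⟩
    h 0 - h (suc (suc F))
      ∎
    where
    open ≡-Reasoning
    regroup : ∀ a b c d → a + c - (b + d) ≡ (a - b) + (c - d)
    regroup = solve-∀
    collapse : ∀ x y z → x - y + (y - z) ≡ x - z
    collapse = solve-∀

  diff-geom : ∀ F c g → diff c (geom F c g) ≗ diff (suc F ℕ.* c) g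
  diff-geom F c g u = begin
    geom F c g u - sumTo F (λ j → g (u - + c - + (j ℕ.* c)))
      ≡⟨ cong (λ z → geom F c g u - z) (sumTo-cong F (λ j _ → cong g (shift u c j))) ⟩
    sumTo F h - sumTo F (h ∘ suc)
      ≡⟨ sumTo-telescope F h ⟩
    g (u - 0ℤ) - g (u - + (suc F ℕ.* c))
      ≡⟨ cong (λ v → g v - g (u - + (suc F ℕ.* c))) (ℤP.+-identityʳ u) ⟩
    g u - g (u - + (suc F ℕ.* c))
      ∎
    where
    open ≡-Reasoning
    h : ℕ → ℤ
    h j = g (u - + (j ℕ.* c))
    shift : ∀ u c j → u - + c - + (j ℕ.* c) ≡ u - + (suc j ℕ.* c)
    shift u c j = trans (assoc u (+ c) (+ (j ℕ.* c))) (cong (λ z → u - z) (sym (ℤP.pos-+ c (j ℕ.* c))))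
      where
      assoc : ∀ u c d → u - c - d ≡ u - (c + d)
      assoc = solve-∀

  diff-agree : ∀ {n b g} → Causal g → n ℕ.≤ b → AgreeBelow n (diff b g) g
  diff-agree {n} {b} {g} cg n≤b u u<n =
    trans (cong (λ z → g u - z) (cg (i<j⇒i-j<0 (ℤP.<-≤-trans u<n (ℤ.+≤+ n≤b))))) (ℤP.+-identityʳ (g u))

  diff-geom-agree : ∀ {n} F c {g} → Causal g → n ℕ.≤ suc F ℕ.* c → AgreeBelow n (diff c (geom F c g)) g
  diff-geom-agree F c {g} cg n≤ = AgreeBelow-trans (≗⇒AgreeBelow (diff-geom F c g)) (diff-agree {g = g} cg n≤)

  -- Strong induction on the index, using g u = ((1 - x^b) g) u + g (u - b).
  diff-cancel : ∀ {n b g h} → 1 ℕ.≤ b → Causal g → Causal h → AgreeBelow n (diff b g) (diff b h) → AgreeBelow n g h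
  diff-cancel {n} {b} {g} {h} 1≤b cg ch eq -[1+ k ] _   = trans (cg ℤ.-<+) (sym (ch ℤ.-<+))
  diff-cancel {n} {b} {g} {h} 1≤b cg ch eq (+ t)    t<n = <-rec P step t t<n
    where
    P : ℕ → Set
    P t = + t < + n → g (+ t) ≡ h (+ t)
    earlier : ∀ t → (∀ {s} → s ℕ.< t → P s) → + t < + n → g (+ t - + b) ≡ h (+ t - + b)
    earlier t rec t<n with b ℕP.≤? t
    ... | yes b≤t = trans (cong g (+m-+n≡+[m∸n] b≤t))
                          (trans (rec (ℕP.∸-monoʳ-< 1≤b b≤t) (ℤP.≤-<-trans (ℤ.+≤+ (ℕP.m∸n≤m t b)) t<n))
                                 (cong h (sym (+m-+n≡+[m∸n] b≤t))))
    ... | no  b≰t = trans (cg t-b<0) (sym (ch t-b<0))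
      where
      t-b<0 : + t - + b < 0ℤ
      t-b<0 = i<j⇒i-j<0 (ℤ.+<+ (ℕP.≰⇒> b≰t))
    step : ∀ t → (∀ {s} → s ℕ.< t → P s) → P t
    step t rec t<n = begin
      g (+ t)                                  ≡⟨ split (g (+ t)) (g (+ t - + b)) ⟩
      diff b g (+ t) + g (+ t - + b)           ≡⟨ cong₂ _+_ (eq (+ t) t<n) (earlier t rec t<n) ⟩
      diff b h (+ t) + h (+ t - + b)           ≡⟨ split (h (+ t)) (h (+ t - + b)) ⟨
      h (+ t)                                  ∎
      where
      open ≡-Reasoning
      split : ∀ x y → x ≡ x - y + y
      split = solve-∀

  diffs : ∀ {k} → (Fin k → ℕ) → Seq → Seq
  diffs b = ⨀ (diff ∘ b)

  diffs-isShiftOperator : ∀ {k} (b : Fin k → ℕ) → IsShiftOperator (diffs b)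
  diffs-isShiftOperator b = ⨀-isShiftOperator (diff-isShiftOperator ∘ b)

  diffs-cancel : ∀ {n k} (b : Fin k → ℕ) {g h} → (∀ i → 1 ℕ.≤ b i) → Causal g → Causal h →
                 AgreeBelow n (diffs b g) (diffs b h) → AgreeBelow n g h
  diffs-cancel {k = zero}  b _   _  _  eq = eq
  diffs-cancel {k = suc k} b 1≤b cg ch eq =
    diffs-cancel (b ∘ Fin.suc) (1≤b ∘ Fin.suc) cg ch (diff-cancel (1≤b Fin.zero) (D.causal cg) (D.causal ch) eq)
    where module D = IsShiftOperator (diffs-isShiftOperator (b ∘ Fin.suc))

  diffs-comm : ∀ {T} → IsShiftOperator T → ∀ {k} (b : Fin k → ℕ) g → T (diffs b g) ≗ diffs b (T g)
  diffs-comm isT {zero}  b g u = refl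
  diffs-comm isT {suc k} b g u =
    trans (T.diff-comm (b Fin.zero) _ u) (diff-cong (b Fin.zero) (diffs-comm isT (b ∘ Fin.suc) g) u)
    where module T = IsShiftOperator isT

  -- (1 - x^a)(1 + x^qa + ⋯ + x^Fqa), which is (1 - x^a)/(1 - x^qa) mod x^n once (F + 1) q a ≥ n
  ratio : ℕ → ℕ → ℕ → Seq → Seq
  ratio F q a = geom F (q ℕ.* a) ∘ diff a

  ratio-isShiftOperator : ∀ F q a → IsShiftOperator (ratio F q a)
  ratio-isShiftOperator F q a = ∘-isShiftOperator (geom-isShiftOperator F (q ℕ.* a)) (diff-isShiftOperator a)

  ratios : ℕ → ℕ → ∀ {k} → (Fin k → ℕ) → Seq → Seq
  ratios F q a = ⨀ (ratio F q ∘ a)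

  ratios-isShiftOperator : ∀ F q {k} (a : Fin k → ℕ) → IsShiftOperator (ratios F q a)
  ratios-isShiftOperator F q a = ⨀-isShiftOperator (ratio-isShiftOperator F q ∘ a)

  diffs-ratios : ∀ {n} F q {k} (a : Fin k → ℕ) {g} → Causal g → (∀ i → n ℕ.≤ suc F ℕ.* (q ℕ.* a i)) →
                 AgreeBelow n (diffs ((q ℕ.*_) ∘ a) (ratios F q a g)) (diffs a g)
  diffs-ratios F q {zero}  a cg large = λ _ _ → refl
  diffs-ratios {n} F q {suc k} a {g} cg large =
    AgreeBelow-trans (≗⇒AgreeBelow commute)
      (AgreeBelow-trans telescope (Δ.agree (diffs-ratios F q (a ∘ Fin.suc) cg (large ∘ Fin.suc))))
    where
    a₀ = a Fin.zero
    q*a = (q ℕ.*_) ∘ a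
    module Δ = IsShiftOperator (diff-isShiftOperator a₀)
    Y = diffs (q*a ∘ Fin.suc) (ratios F q (a ∘ Fin.suc) g)
    Y-causal : Causal Y
    Y-causal = IsShiftOperator.causal (diffs-isShiftOperator (q*a ∘ Fin.suc))
                 (IsShiftOperator.causal (ratios-isShiftOperator F q (a ∘ Fin.suc)) cg)
    commute : diffs q*a (ratios F q a g) ≗ diff (q ℕ.* a₀) (ratio F q a₀ Y)
    commute = diff-cong (q ℕ.* a₀) (sym ∘ diffs-comm (ratio-isShiftOperator F q a₀) (q*a ∘ Fin.suc) _)
    telescope : AgreeBelow n (diff (q ℕ.* a₀) (ratio F q a₀ Y)) (diff a₀ Y)
    telescope = diff-geom-agree F (q ℕ.* a₀) (Δ.causal {Y} Y-causal) (large Fin.zero)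

  diffs-cong : ∀ {k} {b c : Fin k → ℕ} → (∀ i → b i ≡ c i) → ∀ g → diffs b g ≗ diffs c g
  diffs-cong {zero}      b≡c g u = refl
  diffs-cong {suc k} {b} {c} b≡c g u =
    trans (diff-cong (b Fin.zero) (diffs-cong (b≡c ∘ Fin.suc) g) u)
          (cong (λ e → diff e (diffs (c ∘ Fin.suc) g) u) (b≡c Fin.zero))


module Primes where

  open import Defs using (∏ℕ; _÷_)
  open import Data.Nat as ℕ using (ℕ; zero; suc)
  import Data.Nat.Properties as ℕP
  open import Data.Nat.DivMod using (_/_)
  open import Data.Nat.Divisibility using (_∣_; divides; >⇒∤; ∣1⇒≡1; m∣m*n; ∣n⇒∣m*n)
  open import Data.Nat.Primality using (Prime; euclidsLemma; prime⇒irreducible; prime⇒nonZero; prime⇒nonTrivial)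
  open import Data.Nat.Coprimality using (Coprime; coprime-Bézout; coprime-divisor)
  import Data.Nat.GCD as GCD
  open import Data.Integer as ℤ using (ℤ; +_; 0ℤ; 1ℤ; _+_; _-_; -_; _*_; ∣_∣)
  import Data.Integer.Properties as ℤP
  open import Data.Integer.DivMod using (_%ℕ_; _/ℕ_; n%ℕd<d; a≡a%ℕn+[a/ℕn]*n)
  open import Data.Integer.Divisibility.Signed as ℤ∣ using () renaming (_∣_ to _∣ℤ_)
  open import Data.Integer.Tactic.RingSolver using (solve-∀)
  import Data.Nat.Tactic.RingSolver as ℕ-Solver
  open import Data.Fin as Fin using (Fin)
  import Data.Fin.Properties as FinP
  open import Data.Product using (Σ-syntax; _×_; _,_)
  open import Data.Sum using (_⊎_; inj₁; inj₂)
  open import Function using (_∘_)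
  open import Function.Definitions using (Injective)
  open import Relation.Nullary using (¬_; contradiction)
  open import Relation.Binary.PropositionalEquality

  prime-∣ℤ-* : ∀ {p} x y → Prime p → + p ∣ℤ x * y → + p ∣ℤ x ⊎ + p ∣ℤ y
  prime-∣ℤ-* {p} x y isPrime p∣xy with euclidsLemma ∣ x ∣ ∣ y ∣ isPrime (subst (p ∣_) (ℤP.abs-* x y) (ℤ∣.∣⇒∣ᵤ p∣xy))
  ... | inj₁ p∣x = inj₁ (ℤ∣.∣ᵤ⇒∣ p∣x)
  ... | inj₂ p∣y = inj₂ (ℤ∣.∣ᵤ⇒∣ p∣y)

  ∣ℤ-small : ∀ {p x} → + p ∣ℤ x → ∣ x ∣ ℕ.< p → x ≡ 0ℤ
  ∣ℤ-small {p} {x} p∣x ∣x∣<p with ∣ x ∣ in eq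
  ... | zero  = ℤP.∣i∣≡0⇒i≡0 eq
  ... | suc _ = contradiction (subst (p ∣_) eq (ℤ∣.∣⇒∣ᵤ p∣x)) (>⇒∤ ∣x∣<p)

  residue-unique : ∀ {p c i j u} → Prime p → ¬ p ∣ c → i ℕ.< p → j ℕ.< p →
                   + p ∣ℤ u - + (i ℕ.* c) → + p ∣ℤ u - + (j ℕ.* c) → i ≡ j
  residue-unique {p} {c} {i} {j} {u} isPrime p∤c i<p j<p p∣u-ic p∣u-jc =
    conclude (prime-∣ℤ-* (+ i - + j) (+ c) isPrime (subst (+ p ∣ℤ_) difference (ℤ∣.∣m∣n⇒∣m-n p∣u-jc p∣u-ic)))
    where
    difference : u - + (j ℕ.* c) - (u - + (i ℕ.* c)) ≡ (+ i - + j) * + c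
    difference = trans (cong₂ (λ y z → u - y - (u - z)) (ℤP.pos-* j c) (ℤP.pos-* i c)) (factor u (+ i) (+ j) (+ c))
      where
      factor : ∀ u i j c → u - j * c - (u - i * c) ≡ (i - j) * c
      factor = solve-∀
    small : ∣ + i - + j ∣ ℕ.< p
    small = ℕP.≤-<-trans (subst (λ z → ∣ z ∣ ℕ.≤ i ℕ.⊔ j) (sym (ℤP.m-n≡m⊖n i j)) (ℤP.∣m⊝n∣≤m⊔n i j)) (ℕP.⊔-lub i<p j<p)
    conclude : + p ∣ℤ + i - + j ⊎ + p ∣ℤ + c → i ≡ j
    conclude (inj₁ p∣i-j) = ℤP.+-injective (ℤP.i-j≡0⇒i≡j (+ i) (+ j) (∣ℤ-small p∣i-j small))
    conclude (inj₂ p∣c)   = contradiction (ℤ∣.∣⇒∣ᵤ p∣c) p∤c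

  prime∤⇒coprime : ∀ {p c} → Prime p → ¬ p ∣ c → Coprime p c
  prime∤⇒coprime isPrime p∤c (d∣p , d∣c) with prime⇒irreducible isPrime d∣p
  ... | inj₁ d≡1 = d≡1
  ... | inj₂ refl = contradiction d∣c p∤c

  inverse-mod : ∀ {p c} → Prime p → ¬ p ∣ c → Σ[ s ∈ ℤ ] + p ∣ℤ s * + c - 1ℤ
  inverse-mod {p} {c} isPrime p∤c with coprime-Bézout (prime∤⇒coprime isPrime p∤c)
  ... | GCD.Bézout.+- x y eq = - + y , ℤ∣.divides (- + x) (begin
    - + y * + c - 1ℤ         ≡⟨ negate (+ y) (+ c) ⟩
    - (1ℤ + + y * + c)       ≡⟨ cong (λ z → - (1ℤ + z)) (ℤP.pos-* y c) ⟨
    - (1ℤ + + (y ℕ.* c))     ≡⟨ cong -_ (ℤP.pos-+ 1 (y ℕ.* c)) ⟨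
    - + (1 ℕ.+ y ℕ.* c)      ≡⟨ cong (-_ ∘ +_) eq ⟩
    - + (x ℕ.* p)            ≡⟨ cong -_ (ℤP.pos-* x p) ⟩
    - (+ x * + p)            ≡⟨ ℤP.neg-distribˡ-* (+ x) (+ p) ⟩
    - + x * + p              ∎)
    where
    open ≡-Reasoning
    negate : ∀ y c → - y * c - 1ℤ ≡ - (1ℤ + y * c)
    negate = solve-∀
  ... | GCD.Bézout.-+ x y eq = + y , ℤ∣.divides (+ x) (begin
    + y * + c - 1ℤ           ≡⟨ cong (_- 1ℤ) (ℤP.pos-* y c) ⟨
    + (y ℕ.* c) - 1ℤ         ≡⟨ cong (λ z → + z - 1ℤ) eq ⟨
    + (1 ℕ.+ x ℕ.* p) - 1ℤ   ≡⟨ cong (_- 1ℤ) (trans (ℤP.pos-+ 1 (x ℕ.* p)) (cong (λ z → 1ℤ + z) (ℤP.pos-* x p))) ⟩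
    1ℤ + + x * + p - 1ℤ      ≡⟨ cancel (+ x * + p) ⟩
    + x * + p                ∎)
    where
    open ≡-Reasoning
    cancel : ∀ z → 1ℤ + z - 1ℤ ≡ z
    cancel = solve-∀

  -- j ≡ u c⁻¹ (mod p), computed as (u s) mod p for an inverse s of c.
  residue-exists : ∀ {p c} → Prime p → ¬ p ∣ c → ∀ u → Σ[ j ∈ ℕ ] j ℕ.< p × + p ∣ℤ u - + (j ℕ.* c)
  residue-exists {p} {c} isPrime p∤c u =
    let s , p∣sc-1 = inverse-mod isPrime p∤c in
    (u * s) %ℕ p , n%ℕd<d (u * s) p ,
    subst (+ p ∣ℤ_) (sym (expand s))
          (ℤ∣.∣m∣n⇒∣m-n (ℤ∣.divides ((u * s) /ℕ p * + c) refl) (ℤ∣.∣n⇒∣m*n u p∣sc-1))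
    where
    instance
      _ = prime⇒nonZero isPrime
    expand : ∀ s → u - + ((u * s) %ℕ p ℕ.* c) ≡ (u * s) /ℕ p * + c * + p - u * (s * + c - 1ℤ)
    expand s = begin
      u - + ((u * s) %ℕ p ℕ.* c)          ≡⟨ cong (λ z → u - z) (ℤP.pos-* ((u * s) %ℕ p) c) ⟩
      u - + ((u * s) %ℕ p) * + c          ≡⟨ cong (λ z → u - z * + c) (remainder (u * s) r (k * + p) division) ⟩
      u - (u * s - k * + p) * + c         ≡⟨ rearrange u s (+ c) k (+ p) ⟩
      k * + c * + p - u * (s * + c - 1ℤ)  ∎
      where
      open ≡-Reasoning
      k = (u * s) /ℕ p
      r = + ((u * s) %ℕ p)
      division : u * s ≡ r + k * + p
      division = a≡a%ℕn+[a/ℕn]*n (u * s) p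
      remainder : ∀ z r q → z ≡ r + q → r ≡ z - q
      remainder z r q eq = trans (cancel r q) (cong (_- q) (sym eq))
        where
        cancel : ∀ r q → r ≡ r + q - q
        cancel = solve-∀
      rearrange : ∀ u s c q p → u - (u * s - q * p) * c ≡ q * c * p - u * (s * c - 1ℤ)
      rearrange = solve-∀

  ∣⇒∣ℤ : ∀ {a b} → a ∣ b → + a ∣ℤ + b
  ∣⇒∣ℤ = ℤ∣.∣ᵤ⇒∣

  prime>1 : ∀ {p} → Prime p → 1 ℕ.< p
  prime>1 {p} isPrime = ℕ.nonTrivial⇒n>1 p {{prime⇒nonTrivial isPrime}}

  prime∣prime⇒≡ : ∀ {p q} → Prime p → Prime q → p ∣ q → p ≡ q
  prime∣prime⇒≡ p-prime q-prime p∣q with prime⇒irreducible q-prime p∣q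
  ... | inj₁ p≡1 = contradiction p≡1 (ℕP.>⇒≢ (prime>1 p-prime))
  ... | inj₂ p≡q = p≡q

  ∣∏ℕ : ∀ {k} (P : Fin k → ℕ) i → P i ∣ ∏ℕ P
  ∣∏ℕ P Fin.zero    = m∣m*n (∏ℕ (P ∘ Fin.suc))
  ∣∏ℕ P (Fin.suc i) = ∣n⇒∣m*n (P Fin.zero) (∣∏ℕ (P ∘ Fin.suc) i)

  prime∣∏ℕ : ∀ {k p} (P : Fin k → ℕ) → Prime p → (∀ i → Prime (P i)) → p ∣ ∏ℕ P → Σ[ i ∈ Fin k ] p ≡ P i
  prime∣∏ℕ {zero}  P p-prime _     p∣1 = contradiction (∣1⇒≡1 p∣1) (ℕP.>⇒≢ (prime>1 p-prime))
  prime∣∏ℕ {suc k} P p-prime prime p∣∏ with euclidsLemma (P Fin.zero) (∏ℕ (P ∘ Fin.suc)) p-prime p∣∏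
  ... | inj₁ p∣P₀ = Fin.zero , prime∣prime⇒≡ p-prime (prime Fin.zero) p∣P₀
  ... | inj₂ p∣∏′ = let i , p≡Pi = prime∣∏ℕ (P ∘ Fin.suc) p-prime (prime ∘ Fin.suc) p∣∏′ in Fin.suc i , p≡Pi

  module _ {k} (P : Fin (suc k) → ℕ) (prime : ∀ i → Prime (P i)) (inj : Injective _≡_ _≡_ P) where

    head∤∏ℕ-tail : ¬ P Fin.zero ∣ ∏ℕ (P ∘ Fin.suc)
    head∤∏ℕ-tail P₀∣∏ with prime∣∏ℕ (P ∘ Fin.suc) (prime Fin.zero) (prime ∘ Fin.suc) P₀∣∏
    ... | i , P₀≡Pi with inj P₀≡Pi
    ... | ()

    tail-injective : Injective _≡_ _≡_ (P ∘ Fin.suc)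
    tail-injective = FinP.suc-injective ∘ inj

  ∏ℕ-factor : ∀ {k} (P : Fin k → ℕ) → (∀ i → Prime (P i)) → Injective _≡_ _≡_ P →
              ∀ i → Σ[ R ∈ ℕ ] ∏ℕ P ≡ P i ℕ.* R × ¬ P i ∣ R
  ∏ℕ-factor P prime inj Fin.zero    = ∏ℕ (P ∘ Fin.suc) , refl , head∤∏ℕ-tail P prime inj
  ∏ℕ-factor {suc k} P prime inj (Fin.suc i) =
    let R , ∏≡PiR , Pi∤R = ∏ℕ-factor (P ∘ Fin.suc) (prime ∘ Fin.suc) (tail-injective P prime inj) i
    in  P Fin.zero ℕ.* R , trans (cong (P Fin.zero ℕ.*_) ∏≡PiR) (swap (P Fin.zero) (P (Fin.suc i)) R) , not-dividing Pi∤R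
    where
    swap : ∀ a b c → a ℕ.* (b ℕ.* c) ≡ b ℕ.* (a ℕ.* c)
    swap = ℕ-Solver.solve-∀
    not-dividing : ∀ {R} → ¬ P (Fin.suc i) ∣ R → ¬ P (Fin.suc i) ∣ P Fin.zero ℕ.* R
    not-dividing Pi∤R Pi∣P₀R with euclidsLemma (P Fin.zero) _ (prime (Fin.suc i)) Pi∣P₀R
    ... | inj₂ Pi∣R  = Pi∤R Pi∣R
    ... | inj₁ Pi∣P₀ with inj (prime∣prime⇒≡ (prime (Fin.suc i)) (prime Fin.zero) Pi∣P₀)
    ...   | ()

  ∏ℕ-∣ : ∀ {k} (P : Fin k → ℕ) → (∀ i → Prime (P i)) → Injective _≡_ _≡_ P → ∀ {y} → (∀ i → P i ∣ y) → ∏ℕ P ∣ y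
  ∏ℕ-∣ {zero}  P prime inj {y} _   = divides y (sym (ℕP.*-identityʳ y))
  ∏ℕ-∣ {suc k} P prime inj {y} P∣y with ∏ℕ-∣ (P ∘ Fin.suc) (prime ∘ Fin.suc) (tail-injective P prime inj) (P∣y ∘ Fin.suc)
  ... | divides w refl with coprime-divisor (prime∤⇒coprime (prime Fin.zero) (head∤∏ℕ-tail P prime inj))
                                            (subst (P Fin.zero ∣_) (ℕP.*-comm w _) (P∣y Fin.zero))
  ...   | divides v refl = divides v (ℕP.*-assoc v (P Fin.zero) _)

  ÷≡/ : ∀ x {d} .{{_ : ℕ.NonZero d}} → x ÷ d ≡ x / d
  ÷≡/ x {suc d} = refl

  ∏ℕ-nonZero : ∀ {k} (P : Fin k → ℕ) → (∀ i → Prime (P i)) → 1 ℕ.≤ ∏ℕ P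
  ∏ℕ-nonZero {zero}  P prime = ℕP.≤-refl
  ∏ℕ-nonZero {suc k} P prime = ℕP.*-mono-≤ (ℕP.<⇒≤ (prime>1 (prime Fin.zero))) (∏ℕ-nonZero (P ∘ Fin.suc) (prime ∘ Fin.suc))

  ∏ℕ-∣ℤ : ∀ {k} (P : Fin k → ℕ) → (∀ i → Prime (P i)) → Injective _≡_ _≡_ P → ∀ {v} → (∀ i → + P i ∣ℤ v) → + ∏ℕ P ∣ℤ v
  ∏ℕ-∣ℤ P prime inj P∣v = ℤ∣.∣ᵤ⇒∣ (∏ℕ-∣ P prime inj (ℤ∣.∣⇒∣ᵤ ∘ P∣v))


module ChineseRemainder where

  open import Defs using (sumTo)
  open SignedSubsetCounts using (⟦_≤_⟧; signedCount)
  open Sequences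
  open Primes
  open import Data.Nat as ℕ using (ℕ; zero; suc; _*_)
  import Data.Nat.Properties as ℕP
  open import Data.Nat.Divisibility using (_∣_; ∣n⇒∣m*n; ∣m∣n⇒∣m+n; _∣0)
  open import Data.Nat.Primality using (Prime)
  open import Data.Integer as ℤ using (ℤ; +_; 0ℤ; _+_; _-_; -_; _<_)
  import Data.Integer.Properties as ℤP
  open import Data.Integer.Divisibility.Signed as ℤ∣ using () renaming (_∣_ to _∣ℤ_)
  open import Data.Integer.Tactic.RingSolver using (solve-∀)
  open import Data.List using (tabulate)
  open import Data.Nat.ListAction using (sum)
  open import Data.Fin as Fin using (Fin)
  import Data.Fin.Properties as FinP
  open import Data.Product using (_,_; proj₁; proj₂)
  open import Function using (_∘_)
  open import Relation.Nullary using (¬_; yes; no)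
  open import Relation.Binary.PropositionalEquality

  choiceSum : ∀ {k} → (Fin k → ℕ) → (Fin k → ℕ) → Seq → Seq
  choiceSum {zero}  c₀ c₁ g u = g u
  choiceSum {suc k} c₀ c₁ g u = choiceSum (c₀ ∘ Fin.suc) (c₁ ∘ Fin.suc) g (u - + c₀ Fin.zero)
                              - choiceSum (c₀ ∘ Fin.suc) (c₁ ∘ Fin.suc) g (u - + c₁ Fin.zero)

  choiceSum-causal : ∀ {k} (c₀ c₁ : Fin k → ℕ) {g} → Causal g → Causal (choiceSum c₀ c₁ g)
  choiceSum-causal {zero}  c₀ c₁ cg u<0 = cg u<0
  choiceSum-causal {suc k} c₀ c₁ cg u<0 = cong₂ _-_ (IH (i<0⇒i-n<0 (c₀ Fin.zero) u<0)) (IH (i<0⇒i-n<0 (c₁ Fin.zero) u<0))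
    where IH = choiceSum-causal (c₀ ∘ Fin.suc) (c₁ ∘ Fin.suc) cg

  choiceSum-vanishes : ∀ {k} (c₀ c₁ : Fin k → ℕ) {d g} → (∀ i → d ∣ c₀ i) → (∀ i → d ∣ c₁ i) →
                       (∀ {v} → ¬ + d ∣ℤ v → g v ≡ 0ℤ) → ∀ {u} → ¬ + d ∣ℤ u → choiceSum c₀ c₁ g u ≡ 0ℤ
  choiceSum-vanishes {zero}  c₀ c₁ d∣c₀ d∣c₁ vanish d∤u = vanish d∤u
  choiceSum-vanishes {suc k} c₀ c₁ d∣c₀ d∣c₁ vanish d∤u =
    cong₂ _-_ (IH (λ d∣u-c → d∤u (ℤ∣.∣m+n∣n⇒∣m d∣u-c (ℤ∣.∣m⇒∣-m (∣⇒∣ℤ (d∣c₀ Fin.zero))))))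
              (IH (λ d∣u-c → d∤u (ℤ∣.∣m+n∣n⇒∣m d∣u-c (ℤ∣.∣m⇒∣-m (∣⇒∣ℤ (d∣c₁ Fin.zero))))))
    where IH = choiceSum-vanishes (c₀ ∘ Fin.suc) (c₁ ∘ Fin.suc) (d∣c₀ ∘ Fin.suc) (d∣c₁ ∘ Fin.suc) vanish

  -- All 2^k evaluation points are then multiples of d, where g agrees with ⟦ 0 ≤ _ ⟧.
  choiceSum-signedCount : ∀ {k} (c₀ c₁ : Fin k → ℕ) {d g} → (∀ i → + d ∣ℤ + c₁ i - + c₀ i) →
    (∀ {v} → + d ∣ℤ v → g v ≡ ⟦ 0ℤ ≤ v ⟧) → ∀ {u} → + d ∣ℤ u - + sum (tabulate c₀) →
    choiceSum c₀ c₁ g u ≡ signedCount (tabulate (λ i → + c₁ i - + c₀ i)) (u - + sum (tabulate c₀))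
  choiceSum-signedCount {zero}  c₀ c₁ d∣w leaf {u} d∣u =
    trans (leaf (subst (_ ∣ℤ_) (ℤP.+-identityʳ u) d∣u)) (cong ⟦ 0ℤ ≤_⟧ (sym (ℤP.+-identityʳ u)))
  choiceSum-signedCount {suc k} c₀ c₁ {d} d∣w leaf {u} d∣u = begin
    CS (u - + c₀ Fin.zero) - CS (u - + c₁ Fin.zero)
      ≡⟨ cong₂ _-_ (IH (subst (+ d ∣ℤ_) e₀ d∣u)) (IH (subst (+ d ∣ℤ_) e₁ (ℤ∣.∣m∣n⇒∣m-n d∣u (d∣w Fin.zero)))) ⟩
    S (u - + c₀ Fin.zero - + Σ′) - S (u - + c₁ Fin.zero - + Σ′)
      ≡⟨ cong₂ (λ x y → S x - S y) (sym e₀) (sym e₁) ⟩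
    S (u - + Σ) - S (u - + Σ - (+ c₁ Fin.zero - + c₀ Fin.zero))
      ∎
    where
    open ≡-Reasoning
    CS = choiceSum (c₀ ∘ Fin.suc) (c₁ ∘ Fin.suc) _
    S = signedCount (tabulate (λ i → + c₁ (Fin.suc i) - + c₀ (Fin.suc i)))
    IH = choiceSum-signedCount (c₀ ∘ Fin.suc) (c₁ ∘ Fin.suc) (d∣w ∘ Fin.suc) leaf
    Σ′ = sum (tabulate (c₀ ∘ Fin.suc))
    Σ = c₀ Fin.zero ℕ.+ Σ′
    e₀ : u - + Σ ≡ u - + c₀ Fin.zero - + Σ′
    e₀ = trans (cong (λ z → u - z) (ℤP.pos-+ (c₀ Fin.zero) Σ′)) (assoc u (+ c₀ Fin.zero) (+ Σ′))
      where
      assoc : ∀ u a b → u - (a + b) ≡ u - a - b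
      assoc = solve-∀
    e₁ : u - + Σ - (+ c₁ Fin.zero - + c₀ Fin.zero) ≡ u - + c₁ Fin.zero - + Σ′
    e₁ = trans (cong (λ z → u - z - (+ c₁ Fin.zero - + c₀ Fin.zero)) (ℤP.pos-+ (c₀ Fin.zero) Σ′))
               (rearrange u (+ c₀ Fin.zero) (+ Σ′) (+ c₁ Fin.zero))
      where
      rearrange : ∀ u a b c → u - (a + b) - (c - a) ≡ u - c - b
      rearrange = solve-∀

  ∣-sum : ∀ {k d} (c : Fin k → ℕ) → (∀ i → d ∣ c i) → d ∣ sum (tabulate c)
  ∣-sum {zero} {d} c _ = d ∣0
  ∣-sum {suc k} c d∣c = ∣m∣n⇒∣m+n (d∣c Fin.zero) (∣-sum (c ∘ Fin.suc) (d∣c ∘ Fin.suc))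

  u-sum-tabulate : ∀ {k} (c : Fin (suc k) → ℕ) u →
                   u - + c Fin.zero - + sum (tabulate (c ∘ Fin.suc)) ≡ u - + sum (tabulate c)
  u-sum-tabulate c u = trans (assoc u (+ c Fin.zero) _) (cong (λ z → u - z) (sym (ℤP.pos-+ (c Fin.zero) _)))
    where
    assoc : ∀ u a b → u - a - b ≡ u - (a + b)
    assoc = solve-∀

  ∣-minus-sum : ∀ {k d} (c : Fin k → ℕ) i → (∀ j → j ≢ i → d ∣ c j) →
                ∀ {u} → + d ∣ℤ u - + c i → + d ∣ℤ u - + sum (tabulate c)
  ∣-minus-sum {suc k} c Fin.zero    d∣c {u} d∣u-c₀ =
    subst (_ ∣ℤ_) (u-sum-tabulate c u) (ℤ∣.∣m∣n⇒∣m-n d∣u-c₀ (∣⇒∣ℤ (∣-sum (c ∘ Fin.suc) (λ j → d∣c (Fin.suc j) λ ()))))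
  ∣-minus-sum {suc k} c (Fin.suc i) d∣c {u} d∣u-ci =
    subst (_ ∣ℤ_) (u-sum-tabulate c u)
      (∣-minus-sum (c ∘ Fin.suc) i (λ j j≢i → d∣c (Fin.suc j) (j≢i ∘ FinP.suc-injective)) {u - + c Fin.zero}
                   (subst (_ ∣ℤ_) (swap u (+ c (Fin.suc i)) (+ c Fin.zero))
                          (ℤ∣.∣m∣n⇒∣m-n d∣u-ci (∣⇒∣ℤ (d∣c Fin.zero λ ())))))
    where
    swap : ∀ u a b → u - a - b ≡ u - b - a
    swap = solve-∀

  -- Only the term with j ≡ J (mod p) survives: the others vanish off pℤ, or lie at negative indices once j ≥ p.
  sumTo-residue : ∀ {p c J F u} {h : Seq} → Prime p → ¬ p ∣ c → J ℕ.< p → p ℕ.≤ suc F →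
                  Causal h → (∀ {v} → ¬ + p ∣ℤ v → h v ≡ 0ℤ) →
                  + p ∣ℤ u - + (J * c) → u < + (p * c) → sumTo F (λ j → h (u - + (j * c))) ≡ h (u - + (J * c))
  sumTo-residue {p} {c} {J} {F} {u} {h} isPrime p∤c J<p p≤1+F causal vanish p∣u-Jc u<pc =
    sumTo-single F J _ (ℕP.≤-pred (ℕP.≤-trans J<p p≤1+F)) others
    where
    others : ∀ j → j ℕ.≤ F → j ≢ J → h (u - + (j * c)) ≡ 0ℤ
    others j _ j≢J with j ℕP.<? p
    ... | yes j<p = vanish (λ p∣u-jc → j≢J (residue-unique {u = u} isPrime p∤c j<p J<p p∣u-jc p∣u-Jc))
    ... | no  j≮p = causal (i<j⇒i-j<0 (ℤP.<-≤-trans u<pc (ℤ.+≤+ (ℕP.*-monoˡ-≤ c (ℕP.≮⇒≥ j≮p)))))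

  record Separated {k} (q : ℕ) (P a : Fin k → ℕ) : Set where
    field
      prime : ∀ l → Prime (P l)
      P∤qa  : ∀ l → ¬ P l ∣ q * a l
      P∣a   : ∀ {i j} → i ≢ j → P i ∣ a j

  Separated-tail : ∀ {k q} {P a : Fin (suc k) → ℕ} → Separated q P a → Separated q (P ∘ Fin.suc) (a ∘ Fin.suc)
  Separated-tail S = record
    { prime = prime ∘ Fin.suc
    ; P∤qa  = P∤qa ∘ Fin.suc
    ; P∣a   = λ i≢j → P∣a (i≢j ∘ FinP.suc-injective)
    }
    where open Separated S

  record Residues {k} (q : ℕ) (P a : Fin k → ℕ) (u : ℤ) : Set where
    field
      J₀ J₁ : Fin k → ℕ
      J₀<P  : ∀ l → J₀ l ℕ.< P l
      J₁<P  : ∀ l → J₁ l ℕ.< P l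
      P∣u-J₀qa : ∀ l → + P l ∣ℤ u - + (J₀ l * (q * a l))
      P∣u-a-J₁qa : ∀ l → + P l ∣ℤ u - + a l - + (J₁ l * (q * a l))

    offset₀ offset₁ : Fin k → ℕ
    offset₀ l = J₀ l * (q * a l)
    offset₁ l = a l ℕ.+ J₁ l * (q * a l)

  residues : ∀ {k q} {P a : Fin k → ℕ} → Separated q P a → ∀ u → Residues q P a u
  residues S u = record
    { J₀ = λ l → proj₁ (r₀ l) ; J₁ = λ l → proj₁ (r₁ l)
    ; J₀<P = λ l → proj₁ (proj₂ (r₀ l)) ; J₁<P = λ l → proj₁ (proj₂ (r₁ l))
    ; P∣u-J₀qa = λ l → proj₂ (proj₂ (r₀ l)) ; P∣u-a-J₁qa = λ l → proj₂ (proj₂ (r₁ l))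
    }
    where
    open Separated S
    r₀ = λ l → residue-exists (prime l) (P∤qa l) u
    r₁ = λ l → residue-exists (prime l) (P∤qa l) (u - + _)

  Residues-tail : ∀ {k q} {P a : Fin (suc k) → ℕ} {u} → Residues q P a u → Residues q (P ∘ Fin.suc) (a ∘ Fin.suc) u
  Residues-tail R = record
    { J₀ = J₀ ∘ Fin.suc ; J₁ = J₁ ∘ Fin.suc ; J₀<P = J₀<P ∘ Fin.suc ; J₁<P = J₁<P ∘ Fin.suc
    ; P∣u-J₀qa = P∣u-J₀qa ∘ Fin.suc ; P∣u-a-J₁qa = P∣u-a-J₁qa ∘ Fin.suc }
    where open Residues R

  Residues-shift : ∀ {k q} {P a : Fin k → ℕ} {u x} → Residues q P a u → (∀ l → + P l ∣ℤ x) → Residues q P a (u - x)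
  Residues-shift {u = u} {x} R P∣x = record
    { J₀ = J₀ ; J₁ = J₁ ; J₀<P = J₀<P ; J₁<P = J₁<P
    ; P∣u-J₀qa = λ l → subst (_ ∣ℤ_) (swap u x _) (ℤ∣.∣m∣n⇒∣m-n (P∣u-J₀qa l) (P∣x l))
    ; P∣u-a-J₁qa = λ l → subst (_ ∣ℤ_) (swap₂ u x _ _) (ℤ∣.∣m∣n⇒∣m-n (P∣u-a-J₁qa l) (P∣x l)) }
    where
    open Residues R
    swap : ∀ u x y → u - y - x ≡ u - x - y
    swap = solve-∀
    swap₂ : ∀ u x y z → u - y - z - x ≡ u - x - y - z
    swap₂ = solve-∀

  ratio-residue : ∀ {F q a p J₀ J₁ u} {h : Seq} → Prime p → ¬ p ∣ q * a → J₀ ℕ.< p → J₁ ℕ.< p → p ℕ.≤ suc F →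
                  Causal h → (∀ {v} → ¬ + p ∣ℤ v → h v ≡ 0ℤ) →
                  + p ∣ℤ u - + (J₀ * (q * a)) → + p ∣ℤ u - + a - + (J₁ * (q * a)) → u < + (p * (q * a)) →
                  ratio F q a h u ≡ h (u - + (J₀ * (q * a))) - h (u - + (a ℕ.+ J₁ * (q * a)))
  ratio-residue {F} {q} {a} {J₀ = J₀} {J₁} {u} {h} isPrime p∤c J₀<p J₁<p p≤1+F causal vanish p∣u-J₀c p∣u-a-J₁c u<pc = begin
    sumTo F (λ j → h (u - + (j * c)) - h (u - + (j * c) - + a))
      ≡⟨ sumTo-- F _ _ ⟩
    sumTo F (λ j → h (u - + (j * c))) - sumTo F (λ j → h (u - + (j * c) - + a))
      ≡⟨ cong (λ z → sumTo F (λ j → h (u - + (j * c))) - z) (sumTo-cong F (λ j _ → cong h (swap u (+ (j * c)) (+ a)))) ⟩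
    sumTo F (λ j → h (u - + (j * c))) - sumTo F (λ j → h (u - + a - + (j * c)))
      ≡⟨ cong₂ _-_ (sumTo-residue isPrime p∤c J₀<p p≤1+F causal vanish p∣u-J₀c u<pc)
                   (sumTo-residue isPrime p∤c J₁<p p≤1+F causal vanish p∣u-a-J₁c (ℤP.≤-<-trans (ℤP.i-j≤i u (+ a)) u<pc)) ⟩
    h (u - + (J₀ * c)) - h (u - + a - + (J₁ * c))
      ≡⟨ cong (λ v → h (u - + (J₀ * c)) - h v) (trans (assoc u (+ a) _) (cong (λ z → u - z) (sym (ℤP.pos-+ a (J₁ * c))))) ⟩
    h (u - + (J₀ * c)) - h (u - + (a ℕ.+ J₁ * c))
      ∎
    where
    open ≡-Reasoning
    c = q * a
    swap : ∀ u x y → u - x - y ≡ u - y - x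
    swap = solve-∀
    assoc : ∀ u x y → u - x - y ≡ u - (x + y)
    assoc = solve-∀

  -- The inner sum vanishes off P₀ℤ (every offset after the first is a multiple of a₀),
  -- so ratio-residue keeps a single term of each geometric sum.
  ratios-choiceSum : ∀ {k} F q {P a : Fin k → ℕ} {n g u} → Separated q P a → (R : Residues q P a u) →
                     (∀ l → P l ℕ.≤ suc F) → (∀ l → n ℕ.≤ P l * (q * a l)) →
                     Causal g → (∀ l {v} → ¬ + P l ∣ℤ v → g v ≡ 0ℤ) → u < + n →
                     ratios F q a g u ≡ choiceSum (Residues.offset₀ R) (Residues.offset₁ R) g u
  ratios-choiceSum {zero}  F q S R P≤1+F n≤Pqa cg vanish u<n = refl
  ratios-choiceSum {suc k} F q {P} {a} {n} {g} {u} S R P≤1+F n≤Pqa cg vanish u<n = begin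
    ratio F q a₀ Y u
      ≡⟨ sumTo-cong F (λ j _ → cong₂ _-_ (IH (Residues-shift R′ (P∣jc j)) (lt j))
                                        (IH (Residues-shift (Residues-shift R′ (P∣jc j)) P∣a₀) (lt′ j))) ⟩
    ratio F q a₀ H u
      ≡⟨ ratio-residue {F} {q} {a₀} (prime Fin.zero) (P∤qa Fin.zero) (J₀<P Fin.zero) (J₁<P Fin.zero) (P≤1+F Fin.zero)
                       (choiceSum-causal (offset₀ ∘ Fin.suc) (offset₁ ∘ Fin.suc) cg) H-vanish
                       (P∣u-J₀qa Fin.zero) (P∣u-a-J₁qa Fin.zero) (ℤP.<-≤-trans u<n (ℤ.+≤+ (n≤Pqa Fin.zero))) ⟩
    H (u - + offset₀ Fin.zero) - H (u - + offset₁ Fin.zero)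
      ∎
    where
    open ≡-Reasoning
    open Separated S
    open Residues R
    a₀ = a Fin.zero
    Y = ratios F q (a ∘ Fin.suc) g
    H = choiceSum (offset₀ ∘ Fin.suc) (offset₁ ∘ Fin.suc) g
    R′ = Residues-tail R
    IH = λ {v} (R″ : Residues q (P ∘ Fin.suc) (a ∘ Fin.suc) v) →
           ratios-choiceSum F q (Separated-tail S) R″ (P≤1+F ∘ Fin.suc) (n≤Pqa ∘ Fin.suc) cg (vanish ∘ Fin.suc)
    P∣a₀ : ∀ l → + P (Fin.suc l) ∣ℤ + a₀
    P∣a₀ l = ∣⇒∣ℤ (P∣a λ ())
    P∣jc : ∀ j l → + P (Fin.suc l) ∣ℤ + (j * (q * a₀))
    P∣jc j l = ∣⇒∣ℤ (∣n⇒∣m*n j (∣n⇒∣m*n q (P∣a λ ())))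
    lt : ∀ j → u - + (j * (q * a₀)) < + n
    lt j = ℤP.≤-<-trans (ℤP.i-j≤i u _) u<n
    lt′ : ∀ j → u - + (j * (q * a₀)) - + a₀ < + n
    lt′ j = ℤP.≤-<-trans (ℤP.i-j≤i _ (+ a₀)) (lt j)
    H-vanish : ∀ {v} → ¬ + P Fin.zero ∣ℤ v → H v ≡ 0ℤ
    H-vanish = choiceSum-vanishes (offset₀ ∘ Fin.suc) (offset₁ ∘ Fin.suc)
      (λ l → ∣n⇒∣m*n (J₀ (Fin.suc l)) (∣n⇒∣m*n q (P∣a λ ())))
      (λ l → ∣m∣n⇒∣m+n (P∣a λ ()) (∣n⇒∣m*n (J₁ (Fin.suc l)) (∣n⇒∣m*n q (P∣a λ ()))))
      (vanish Fin.zero)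


module Coefficients where

  open import Defs
  open SignedSubsetCounts using (⟦_≤_⟧; ⟦≤⟧-true; ⟦≤⟧-false; signedCount; signedCount-bound)
  open Sequences
  open Primes
  open ChineseRemainder
  open import Data.Nat as ℕ using (ℕ; zero; suc; _*_; _∸_; z≤n)
  import Data.Nat.Properties as ℕP
  open import Data.Nat.DivMod using (_/_; m*[n/m]≡n; *-/-assoc; m*n/n≡m)
  open import Data.Nat.Divisibility using (_∣_; _∣?_; _∣0; ∣-trans; ∣m+n∣m⇒∣n; ∣m∣n⇒∣m+n; ∣-refl; >⇒∤; ∣n⇒∣m*n; ∣⇒≤)
  open import Data.Nat.Primality using (Prime; euclidsLemma; prime⇒nonZero)
  open import Data.Nat.Combinatorics using (_C_)
  open import Data.Integer as ℤ using (ℤ; +_; -[1+_]; 0ℤ; 1ℤ; _+_; _-_; _<_; ∣_∣)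
  import Data.Integer.Properties as ℤP
  open import Data.Integer.Divisibility.Signed as ℤ∣ using () renaming (_∣_ to _∣ℤ_)
  open import Data.Integer.Tactic.RingSolver using (solve-∀)
  import Data.Nat.Tactic.RingSolver as ℕ-Solver
  open import Data.List using (List; tabulate; length)
  open import Data.List.Properties using (length-tabulate)
  open import Data.Nat.ListAction using (sum)
  open import Data.Fin as Fin using (Fin)
  open import Data.Product using (_×_; _,_; proj₁)
  open import Data.Sum using (inj₁; inj₂)
  open import Function using (_∘_)
  open import Function.Definitions using (Injective)
  open import Relation.Nullary using (¬_; yes; no; contradiction)
  open import Relation.Binary.PropositionalEquality

  δ : Seq
  δ = toSeq oneₛ

  -- Σⱼ x^{j m}, i.e. 1/(1 - x^m)
  multiplesOf : ℕ → Seq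
  multiplesOf m -[1+ _ ] = 0ℤ
  multiplesOf m (+ t) with m ∣? t
  ... | yes _ = 1ℤ
  ... | no  _ = 0ℤ

  multiplesOf-∣ : ∀ {m t} → m ∣ t → multiplesOf m (+ t) ≡ 1ℤ
  multiplesOf-∣ {m} {t} m∣t with m ∣? t
  ... | yes _   = refl
  ... | no  m∤t = contradiction m∣t m∤t

  multiplesOf-∤ : ∀ {m t} → ¬ m ∣ t → multiplesOf m (+ t) ≡ 0ℤ
  multiplesOf-∤ {m} {t} m∤t with m ∣? t
  ... | yes m∣t = contradiction m∣t m∤t
  ... | no  _   = refl

  multiplesOf-causal : ∀ m → Causal (multiplesOf m)
  multiplesOf-causal m { -[1+ _ ]} _          = refl
  multiplesOf-causal m {+ _}       (ℤ.+<+ ())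

  multiplesOf-vanishes : ∀ {d m} → d ∣ m → ∀ {v} → ¬ + d ∣ℤ v → multiplesOf m v ≡ 0ℤ
  multiplesOf-vanishes {d} {m} d∣m { -[1+ _ ]} _   = refl
  multiplesOf-vanishes {d} {m} d∣m {+ t}       d∤t with m ∣? t
  ... | yes m∣t = contradiction (∣⇒∣ℤ (∣-trans d∣m m∣t)) d∤t
  ... | no  _   = refl

  multiplesOf-⟦0≤⟧ : ∀ {m v} → + m ∣ℤ v → multiplesOf m v ≡ ⟦ 0ℤ ≤ v ⟧
  multiplesOf-⟦0≤⟧ {m} {+ t}       m∣t = trans (multiplesOf-∣ (ℤ∣.∣⇒∣ᵤ m∣t)) (sym (⟦≤⟧-true {0ℤ} {+ t} (ℤ.+≤+ z≤n)))
  multiplesOf-⟦0≤⟧ {m} { -[1+ t ]} _   = sym (⟦≤⟧-false {0ℤ} { -[1+ t ]} λ ())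

  multiplesOf-step : ∀ {m t} → m ℕ.≤ t → multiplesOf m (+ t) ≡ multiplesOf m (+ (t ∸ m))
  multiplesOf-step {m} {t} m≤t with m ∣? t | m ∣? (t ∸ m)
  ... | yes _   | yes _     = refl
  ... | no  _   | no  _     = refl
  ... | yes m∣t | no  m∤t-m = contradiction (∣m+n∣m⇒∣n (subst (m ∣_) (sym (ℕP.m+[n∸m]≡n m≤t)) m∣t) ∣-refl) m∤t-m
  ... | no  m∤t | yes m∣t-m = contradiction (subst (m ∣_) (ℕP.m+[n∸m]≡n m≤t) (∣m∣n⇒∣m+n ∣-refl m∣t-m)) m∤t

  diff-multiplesOf : ∀ {m} → 1 ℕ.≤ m → diff m (multiplesOf m) ≗ δ
  diff-multiplesOf {m} 1≤m -[1+ k ] = cong (λ z → 0ℤ - z) (multiplesOf-causal m (i<0⇒i-n<0 m ℤ.-<+))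
  diff-multiplesOf {m} 1≤m (+ t) with m ℕP.≤? t
  ... | yes m≤t = begin
    multiplesOf m (+ t) - multiplesOf m (+ t - + m)
      ≡⟨ cong₂ _-_ (multiplesOf-step m≤t) (cong (multiplesOf m) (+m-+n≡+[m∸n] m≤t)) ⟩
    M - M
      ≡⟨ ℤP.+-inverseʳ M ⟩
    0ℤ
      ≡⟨ X^-≢ (ℕP.<⇒≢ (ℕP.<-≤-trans 1≤m m≤t)) ⟨
    δ (+ t)
      ∎
    where
    open ≡-Reasoning
    M = multiplesOf m (+ (t ∸ m))
  ... | no  m≰t = trans (cong (λ z → multiplesOf m (+ t) - z) (multiplesOf-causal m (i<j⇒i-j<0 (ℤ.+<+ t<m))))
                        (below t t<m)
    where
    t<m = ℕP.≰⇒> m≰t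
    below : ∀ t → t ℕ.< m → multiplesOf m (+ t) - 0ℤ ≡ δ (+ t)
    below zero    _   = cong (_- 0ℤ) (multiplesOf-∣ (m ∣0))
    below (suc t) t<m = cong (_- 0ℤ) (multiplesOf-∤ (>⇒∤ t<m))

  module Setting {r} (p : Fin (suc r) → ℕ) (prime : ∀ i → Prime (p i)) (inj : Injective _≡_ _≡_ p) where

    q : ℕ
    q = p Fin.zero

    P : Fin r → ℕ
    P = p ∘ Fin.suc

    m : ℕ
    m = ∏ℕ P

    n : ℕ
    n = ∏ℕ p

    a : Fin r → ℕ
    a l = m ÷ P l

    instance
      q-nonZero : ℕ.NonZero q
      q-nonZero = prime⇒nonZero (prime Fin.zero)
      P-nonZero : ∀ {l} → ℕ.NonZero (P l)
      P-nonZero {l} = prime⇒nonZero (prime (Fin.suc l))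

    P-prime : ∀ l → Prime (P l)
    P-prime = prime ∘ Fin.suc

    P-injective : Injective _≡_ _≡_ P
    P-injective = tail-injective p prime inj

    P*a≡m : ∀ l → P l * a l ≡ m
    P*a≡m l = trans (cong (P l *_) (÷≡/ m)) (m*[n/m]≡n (∣∏ℕ P l))

    P∣a : ∀ {i j} → i ≢ j → P i ∣ a j
    P∣a {i} {j} i≢j with euclidsLemma (P j) (a j) (P-prime i) (subst (P i ∣_) (sym (P*a≡m j)) (∣∏ℕ P i))
    ... | inj₁ Pi∣Pj = contradiction (P-injective (prime∣prime⇒≡ (P-prime i) (P-prime j) Pi∣Pj)) i≢j
    ... | inj₂ Pi∣aj = Pi∣aj

    P∤a : ∀ l → ¬ P l ∣ a l
    P∤a l with ∏ℕ-factor P P-prime P-injective l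
    ... | R , m≡PR , P∤R = P∤R ∘ subst (P l ∣_) (ℕP.*-cancelˡ-≡ (a l) R (P l) (trans (P*a≡m l) m≡PR))

    P∤qa : ∀ l → ¬ P l ∣ q * a l
    P∤qa l Pl∣qa with euclidsLemma q (a l) (P-prime l) Pl∣qa
    ... | inj₁ Pl∣q  = contradiction (inj (prime∣prime⇒≡ (P-prime l) (prime Fin.zero) Pl∣q)) λ ()
    ... | inj₂ Pl∣al = P∤a l Pl∣al

    separated : Separated q P a
    separated = record { prime = P-prime ; P∤qa = P∤qa ; P∣a = P∣a }

    1≤m : 1 ℕ.≤ m
    1≤m = ∏ℕ-nonZero P P-prime

    1≤a : ∀ l → 1 ℕ.≤ a l
    1≤a l = ℕP.n≢0⇒n>0 λ al≡0 → ℕP.<⇒≢ 1≤m (sym (trans (sym (P*a≡m l)) (trans (cong (P l *_) al≡0) (ℕP.*-zeroʳ (P l)))))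

    b : Fin (suc r) → ℕ
    b Fin.zero    = m
    b (Fin.suc l) = q * a l

    exponents : ∀ i → n ÷ p i ≡ b i
    exponents Fin.zero    = trans (÷≡/ n) (trans (cong (_/ q) (ℕP.*-comm q m)) (m*n/n≡m m q))
    exponents (Fin.suc l) = trans (÷≡/ n) (trans (*-/-assoc q (∣∏ℕ P l)) (cong (q *_) (sym (÷≡/ m))))

    1≤b : ∀ i → 1 ℕ.≤ b i
    1≤b Fin.zero    = 1≤m
    1≤b (Fin.suc l) = ℕP.*-mono-≤ (ℕP.<⇒≤ (prime>1 (prime Fin.zero))) (1≤a l)

    f-diffs : ∀ {f} → (∀ t → (denominator p *ₛ f) t ≡ numerator p t) → AgreeBelow n (diffs b (toSeq f)) (diffs a δ)
    f-diffs {f} hyp = AgreeBelow-trans (≗⇒AgreeBelow step) (diff-agree {g = diffs a δ} causal ℕP.≤-refl)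
      where
      causal : Causal (diffs a δ)
      causal = IsShiftOperator.causal (diffs-isShiftOperator a) (toSeq-causal oneₛ)
      step : diffs b (toSeq f) ≗ diff n (diffs a δ)
      step u = begin
        diffs b (toSeq f) u                            ≡⟨ diffs-cong exponents (toSeq f) u ⟨
        diffs (λ i → n ÷ p i) (toSeq f) u              ≡⟨ toSeq-∏ₛ-*ₛ (λ i → n ÷ p i) f u ⟨
        toSeq (denominator p *ₛ f) u                   ≡⟨ toSeq-cong hyp u ⟩
        toSeq (numerator p) u                          ≡⟨ toSeq-oneMinusX^-*ₛ n _ u ⟩
        diff n (toSeq (∏ₛ (oneMinusX^ ∘ a))) u         ≡⟨ diff-cong n (toSeq-cong (sym ∘ *ₛ-identityʳ _)) u ⟩
        diff n (toSeq (∏ₛ (oneMinusX^ ∘ a) *ₛ oneₛ)) u ≡⟨ diff-cong n (toSeq-∏ₛ-*ₛ a oneₛ) u ⟩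
        diff n (diffs a δ) u                           ∎
        where open ≡-Reasoning

    E : Seq
    E = ratios n q a (multiplesOf m)

    E-causal : Causal E
    E-causal = IsShiftOperator.causal (ratios-isShiftOperator n q a) (multiplesOf-causal m)

    E-diffs : AgreeBelow n (diffs b E) (diffs a δ)
    E-diffs = AgreeBelow-trans (≗⇒AgreeBelow step) (diffs-ratios n q a (toSeq-causal oneₛ) large)
      where
      module Δs = IsShiftOperator (diffs-isShiftOperator ((q *_) ∘ a))
      module R = IsShiftOperator (ratios-isShiftOperator n q a)
      large : ∀ l → n ℕ.≤ suc n * (q * a l)
      large l = ℕP.≤-trans (ℕP.n≤1+n n) (ℕP.m≤m*n (suc n) (q * a l) {{ℕ.>-nonZero (1≤b (Fin.suc l))}})
      step : diffs b E ≗ diffs ((q *_) ∘ a) (ratios n q a δ)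
      step u = begin
        diff m (diffs ((q *_) ∘ a) E) u                     ≡⟨ diffs-comm (diff-isShiftOperator m) ((q *_) ∘ a) E u ⟩
        diffs ((q *_) ∘ a) (diff m E) u                     ≡⟨ Δs.≗-cong (λ v → sym (R.diff-comm m (multiplesOf m) v)) u ⟩
        diffs ((q *_) ∘ a) (ratios n q a (diff m (multiplesOf m))) u ≡⟨ Δs.≗-cong (R.≗-cong (diff-multiplesOf 1≤m)) u ⟩
        diffs ((q *_) ∘ a) (ratios n q a δ) u               ∎
        where open ≡-Reasoning

    f≈E : ∀ {f} → (∀ t → (denominator p *ₛ f) t ≡ numerator p t) → AgreeBelow n (toSeq f) E
    f≈E {f} hyp = diffs-cancel b 1≤b (toSeq-causal f) E-causal (AgreeBelow-trans (f-diffs hyp) (AgreeBelow-sym E-diffs))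

    module _ (u : ℤ) where
      open Residues (residues separated u)

      weights : List ℤ
      weights = tabulate (λ l → + offset₁ l - + offset₀ l)

      length-weights : length weights ≡ r
      length-weights = length-tabulate _

      base : ℤ
      base = u - + sum (tabulate offset₀)

      P∣offsets : ∀ {l i} → l ≢ i → (P l ∣ offset₀ i) × (P l ∣ offset₁ i)
      P∣offsets {l} {i} l≢i = ∣n⇒∣m*n (J₀ i) (∣n⇒∣m*n q (P∣a l≢i)) ,
                              ∣m∣n⇒∣m+n (P∣a l≢i) (∣n⇒∣m*n (J₁ i) (∣n⇒∣m*n q (P∣a l≢i)))

      P∣weight : ∀ l i → + P l ∣ℤ + offset₁ i - + offset₀ i
      P∣weight l i with l Fin.≟ i
      ... | yes refl = subst (_ ∣ℤ_) difference (ℤ∣.∣m∣n⇒∣m-n (P∣u-J₀qa l) (P∣u-a-J₁qa l))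
        where
        difference : u - + offset₀ l - (u - + a l - + (J₁ l * (q * a l))) ≡ + offset₁ l - + offset₀ l
        difference = trans (rearrange u (+ offset₀ l) (+ a l) _) (cong (_- + offset₀ l) (sym (ℤP.pos-+ (a l) _)))
          where
          rearrange : ∀ u o a x → u - o - (u - a - x) ≡ a + x - o
          rearrange = solve-∀
      ... | no  l≢i  = let P∣o₀ , P∣o₁ = P∣offsets l≢i in ℤ∣.∣m∣n⇒∣m-n (∣⇒∣ℤ P∣o₁) (∣⇒∣ℤ P∣o₀)

      P∣base : ∀ l → + P l ∣ℤ base
      P∣base l = ∣-minus-sum offset₀ l (λ j j≢l → proj₁ (P∣offsets (j≢l ∘ sym))) {u} (P∣u-J₀qa l)

      E-signedCount : u < + n → E u ≡ signedCount weights base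
      E-signedCount u<n =
        trans (ratios-choiceSum n q separated (residues separated u) P≤1+n n≤Pqa (multiplesOf-causal m)
                                (λ l → multiplesOf-vanishes (∣∏ℕ P l)) u<n)
              (choiceSum-signedCount offset₀ offset₁ (λ i → ∏ℕ-∣ℤ P P-prime P-injective (λ l → P∣weight l i))
                                     multiplesOf-⟦0≤⟧ (∏ℕ-∣ℤ P P-prime P-injective P∣base))
        where
        P≤1+n : ∀ l → P l ℕ.≤ suc n
        P≤1+n l = ℕP.m≤n⇒m≤1+n (ℕP.≤-trans (∣⇒≤ {{ℕ.>-nonZero 1≤m}} (∣∏ℕ P l)) (ℕP.m≤n*m m q))
        n≤Pqa : ∀ l → n ℕ.≤ P l * (q * a l)
        n≤Pqa l = ℕP.≤-reflexive (trans (cong (q *_) (sym (P*a≡m l))) (swap q (P l) (a l)))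
          where
          swap : ∀ x y z → x * (y * z) ≡ y * (x * z)
          swap = ℕ-Solver.solve-∀

    coefficient-bound : ∀ f → (∀ t → (denominator p *ₛ f) t ≡ numerator p t) →
                        ∀ {t} → t ℕ.< n → ∣ f t ∣ ℕ.≤ (r ∸ 1) C ((r ∸ 1) / 2)
    coefficient-bound f hyp {t} t<n = begin
      ∣ f t ∣                                      ≡⟨ cong ∣_∣ (trans (f≈E {f} hyp (+ t) t<n′) (E-signedCount (+ t) t<n′)) ⟩
      ∣ signedCount (weights (+ t)) (base (+ t)) ∣ ≤⟨ signedCount-bound (weights (+ t)) (base (+ t)) ⟩
      bound (length (weights (+ t)))               ≡⟨ cong bound (length-weights (+ t)) ⟩
      bound r                                      ∎
      where
      open ℕP.≤-Reasoning
      t<n′ = ℤ.+<+ t<n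
      bound : ℕ → ℕ
      bound l = (l ∸ 1) C ((l ∸ 1) / 2)


open import Defs
open import Data.Nat using (ℕ; zero; suc; _≤_; _∸_; _/_; _<?_; z≤n; s≤s)
open import Data.Nat.Combinatorics using (_C_)
open import Data.Nat.Primality using (Prime)
open import Data.Integer using (∣_∣)
open import Data.Fin using (Fin)
open import Function.Definitions using (Injective)
open import Relation.Binary.PropositionalEquality using (_≡_)
open import Relation.Nullary using (yes; no)
open Coefficients using (module Setting)

lemma2 : (k : ℕ) → 2 ≤ k → (p : Fin k → ℕ) → (∀ i → Prime (p i)) → Injective _≡_ _≡_ p →
    (f : PowerSeries) → (∀ m → (denominator p *ₛ f) m ≡ numerator p m) →
    ∀ m → ∣ truncate (∏ℕ p) f m ∣ ≤ (k ∸ 2) C ((k ∸ 2) / 2)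
lemma2 (suc (suc k)) _ p prime inj f hyp t with t <? ∏ℕ p
... | yes t<n = Setting.coefficient-bound p prime inj f hyp t<n
... | no  _   = z≤n
lemma2 (suc zero) (s≤s ())
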